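{- (Free Construction.) Let $\mathcal{R}$ be a representable signature, $\mathsf{S}$ a representable multicategory, and $i$ a map of representable signatures from $\mathcal{R}$ to the underlying signature of $\mathsf{S}$. Then there exists a unique representable functor $i^\ast : \mathcal{F}(\mathcal{R}) \to \mathsf{S}$ such that $i^\ast(a) = i(a)$ for every type $a$ and $i^\ast([f(x_1,\dots,x_n)]) = i(f)$ for every multiarrow $f$ of $\mathcal{R}$ (i.e. $i$ factors as the underlying map of $i^\ast$ composed with the inclusion of $\mathcal{R}$ into $\mathcal{F}(\mathcal{R})$).
   Context: A representable signature consists of a set $\mathcal{A}$ of atoms and a multigraph $\mathcal{R}$ whose nodes (types) are generated by $a ::= o \in \mathcal{A} \mid (a_1 \otimes \cdots \otimes a_k)$ for $k \in \mathbb{N}$, with sets $\mathcal{R}(a_1,\dots,a_n;b)$ of multiarrows. A representable multicategory is a multicategory $\mathsf{S}$ with chosen objects $(a_1\otimes\cdots\otimes a_k)$ and morphisms $\mathsf{re}: a_1,\dots,a_k \to (a_1\otimes\cdots\otimes a_k)$ for all objects $a_1,\dots,a_k$, such that precomposition with $\mathsf{re}$ (with identities elsewhere) induces bijections $\mathsf{S}(\gamma,(a_1\otimes\cdots\otimes a_k),\delta;a) \cong \mathsf{S}(\gamma,a_1,\dots,a_k,\delta;a)$. A representable functor preserves composition, identities, chosen tensor objects and the morphisms $\mathsf{re}$ on the nose. A map of representable signatures $i$ from $\mathcal{R}$ to $\mathsf{S}$ assigns to each type $a$ an object $i(a)$ with $i((a_1\otimes\cdots\otimes a_k)) = (i(a_1)\otimes\cdots\otimes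 i(a_k))$ and to each $f\in\mathcal{R}(a_1,\dots,a_n;b)$ a morphism $i(f)\in\mathsf{S}(i(a_1),\dots,i(a_n);i(b))$. Representable terms: $s,t ::= x \mid \langle s_1,\dots,s_k\rangle \mid s[x_1^{a_1},\dots,x_k^{a_k} := t] \mid f(s_1,\dots,s_n)$; in $s[\vec{x} := t]$ the $x_i$ are bound in $s$; terms up to renaming of bound variables. Typing rules: $x:a \vdash x:a$; if $f \in \mathcal{R}(a_1,\dots,a_n;b)$ and $\gamma_i \vdash s_i : a_i$ then $\gamma_1,\dots,\gamma_n \vdash f(s_1,\dots,s_n) : b$; if $\gamma_i \vdash s_i : a_i$ then $\gamma_1,\dots,\gamma_k \vdash \langle s_1,\dots,s_k\rangle : (a_1\otimes\cdots\otimes a_k)$; if $\gamma \vdash t : (a_1 \otimes\cdots\otimes a_k)$ and $\delta, x_1:a_1,\dots,x_k:a_k, \delta' \vdash s : b$ then $\delta,\gamma,\delta' \vdash s[x_1^{a_1},\dots,x_k^{a_k} := t] : b$; combined contexts are disjoint lists of distinct variables. $\mathrm{Rep}(\mathcal{R})(a_1,\dots,a_n;a)$ = terms $s$ with $x_1:a_1,\dots,x_n:a_n \vdash s : a$. Contexts with one hole: $\mathtt{C} ::= [\cdot] \mid \langle s_1,\dots,\mathtt{C},\dots,s_k\rangle \mid \mathtt{C}[\vec{x}:=t] \mid s[\vec{x} := \mathtt{C}] \mid f(s_1,\dots,\mathtt{C},\dots,s_n)$; $\mathtt{E}$ same grammar except that $s[\vec{x} := \mathtt{E}]$ requires $\mathtt{E}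 \neq [\cdot]$; $\mathtt{L} ::= [\cdot] \mid \mathtt{L}[\vec{x} := t]$; $\mathsf{LT}$ = terms $\mathtt{L}[\langle s_1,\dots,s_k\rangle]$. $\beta$: $s[x_1,\dots,x_k := \mathtt{L}[\langle t_1,\dots,t_k\rangle]] \to_\beta \mathtt{L}[s\{t_1/x_1,\dots,t_k/x_k\}]$, closed under $\mathtt{C}$-contexts; $\eta$: $s \to_\eta \langle x_1,\dots,x_k\rangle[x_1^{a_1},\dots,x_k^{a_k} := s]$ when $s$ has type $(a_1\otimes\cdots\otimes a_k)$, $x_i$ fresh, $s\notin\mathsf{LT}$, closed under $\mathtt{E}$-contexts; $\to_{\mathsf{rep}} = \to_\beta\cup\to_\eta$. Structural equivalence $\equiv$: smallest congruence containing $\mathtt{C}[s[\vec{x}:=t]] \equiv \mathtt{C}[s][\vec{x}:=t]$ whenever $\mathtt{C}$ binds no free variable of $t$ and $\vec{x}$ do not occur free in $\mathtt{C}$. $\mathcal{F}(\mathcal{R})$ is the multicategory with the types as objects, $\mathcal{F}(\mathcal{R})(\gamma;a) = \mathrm{Rep}(\mathcal{R})(\gamma;a)/\sim$ with $\sim$ the equivalence generated by $\equiv$ and $\to_{\mathsf{rep}}$, composition by substitution $[s]\circ\langle[t_1],\dots,[t_n]\rangle = [s\{t_1/x_1,\dots,t_n/x_n\}]$, identities $[x]$; it is representable with tensor objects the tensor types and $\mathsf{re} = [\langle x_1,\dots,x_k\rangle]$. -}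

module Defs where

open import Level using (Level; _⊔_; 0ℓ) renaming (suc to lsuc)
open import Data.List using (List; []; _∷_; _++_; map; [_])
open import Data.List.Properties using (++-assoc; ++-identityʳ; map-++; map-cong)
open import Data.Product using (Σ; _×_; _,_)
open import Data.Unit using (⊤)
open import Data.Empty using (⊥)
open import Relation.Nullary using (¬_)
open import Relation.Binary.PropositionalEquality
  using (_≡_; refl; sym; trans; cong; subst; subst₂)
open import Relation.Binary.Structures using (IsEquivalence)
open import Relation.Binary.Construct.Closure.Equivalence using (EqClosure)

reassoc : ∀ {a} {X : Set a} (A B C D E : List X) →
          A ++ ((B ++ (C ++ D)) ++ E) ≡ (A ++ B) ++ (C ++ (D ++ E))
reassoc A B C D E =
  trans (cong (A ++_) (++-assoc B (C ++ D) E))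
  (trans (cong (λ z → A ++ (B ++ z)) (++-assoc C D E))
         (sym (++-assoc A B (C ++ (D ++ E)))))

reassoc₂ : ∀ {a} {X : Set a} (A B C D : List X) →
           A ++ (B ++ (C ++ D)) ≡ (A ++ (B ++ C)) ++ D
reassoc₂ A B C D =
  trans (cong (λ z → A ++ z) (sym (++-assoc B C D)))
        (sym (++-assoc A (B ++ C) D))

module HomLists {o h} {Obj : Set o} (Hom : List Obj → Obj → Set h) where

  data HomList : List Obj → List Obj → Set (o ⊔ h) where
    []  : HomList [] []
    _∷_ : ∀ {Γ Δ a as} → Hom Γ a → HomList Δ as → HomList (Γ ++ Δ) (a ∷ as)

  castL : ∀ {Γ Γ' as} → Γ ≡ Γ' → HomList Γ as → HomList Γ' as
  castL {as = as} eq = subst (λ G → HomList G as) eq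

  infixr 5 _++H_
  _++H_ : ∀ {Γ₁ Γ₂ as bs} → HomList Γ₁ as → HomList Γ₂ bs →
          HomList (Γ₁ ++ Γ₂) (as ++ bs)
  [] ++H gs = gs
  (_∷_ {Γ} {Δ} f fs) ++H (_∷_ {Γ'} {Δ'} g gs) =
    castL (sym (++-assoc Γ Δ (Γ' ++ Δ'))) (f ∷ (fs ++H (g ∷ gs)))
  (_∷_ {Γ} {Δ} f fs) ++H [] =
    castL (sym (++-assoc Γ Δ [])) (f ∷ (fs ++H []))

  split : ∀ (as bs : List Obj) {Γ} → HomList Γ (as ++ bs) →
          Σ (List Obj) λ Γ₁ → Σ (List Obj) λ Γ₂ →
            (Γ ≡ Γ₁ ++ Γ₂) × HomList Γ₁ as × HomList Γ₂ bs
  split [] bs fs = [] , _ , refl , [] , fs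
  split (a ∷ as) bs (_∷_ {Γa} f fs) with split as bs fs
  ... | Γ₁ , Γ₂ , eq , fs₁ , fs₂ =
    Γa ++ Γ₁ , Γ₂ , trans (cong (Γa ++_) eq) (sym (++-assoc Γa Γ₁ Γ₂)) ,
    f ∷ fs₁ , fs₂

record MultiData (o h e : Level) : Set (lsuc (o ⊔ h ⊔ e)) where
  field
    Obj : Set o
    Hom : List Obj → Obj → Set h
    _≈_ : ∀ {Γ a} → Hom Γ a → Hom Γ a → Set e
    id  : ∀ a → Hom [ a ] a
    _∘_ : ∀ {Γ as b} → Hom as b → HomLists.HomList Hom Γ as → Hom Γ b
    ⊗   : List Obj → Obj
    re  : ∀ as → Hom as (⊗ as)

module MOps {o h e} (M : MultiData o h e) where
  open MultiData M
  open HomLists Hom public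

  idsL : ∀ as → HomList as as
  idsL []       = []
  idsL (a ∷ as) = id a ∷ idsL as

  single : ∀ {Γ a} → Hom Γ a → HomList Γ [ a ]
  single {Γ} f = castL (++-identityʳ Γ) (f ∷ [])

  _∘*_ : ∀ {Γ Δ bs} → HomList Δ bs → HomList Γ Δ → HomList Γ bs
  [] ∘* [] = []
  (_∷_ {Δ₁} {Δ₂} f fs) ∘* gs with split Δ₁ Δ₂ gs
  ... | Γ₁ , Γ₂ , eq , gs₁ , gs₂ = castL (sym eq) ((f ∘ gs₁) ∷ (fs ∘* gs₂))

  data _≈*_ : ∀ {Γ as} → HomList Γ as → HomList Γ as → Set (o ⊔ h ⊔ e) where
    []  : [] ≈* []
    _∷_ : ∀ {Γ Δ a as} {f f' : Hom Γ a} {fs fs' : HomList Δ as} →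
          f ≈ f' → fs ≈* fs' → (f ∷ fs) ≈* (f' ∷ fs')

  precomp : ∀ γ as δ {a} → Hom (γ ++ ⊗ as ∷ δ) a → Hom (γ ++ as ++ δ) a
  precomp γ as δ f = f ∘ (idsL γ ++H (re as ∷ idsL δ))

module _ {o h e} (M : MultiData o h e) where
  open MultiData M
  open MOps M

  record IsRepMulticategory : Set (o ⊔ h ⊔ e) where
    field
      ≈-equiv   : ∀ {Γ a} → IsEquivalence (_≈_ {Γ} {a})
      ∘-cong    : ∀ {Γ as b} {f f' : Hom as b} {fs fs' : HomList Γ as} →
                  f ≈ f' → fs ≈* fs' → (f ∘ fs) ≈ (f' ∘ fs')
      id-left   : ∀ {Γ a} (f : Hom Γ a) → (id a ∘ single f) ≈ f
      id-right  : ∀ {as b} (f : Hom as b) → (f ∘ idsL as) ≈ f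
      assoc     : ∀ {Γ Δ as b} (f : Hom as b) (gs : HomList Δ as)
                  (hs : HomList Γ Δ) → ((f ∘ gs) ∘ hs) ≈ (f ∘ (gs ∘* hs))
      rep-surj  : ∀ γ as δ {a} (g : Hom (γ ++ as ++ δ) a) →
                  Σ (Hom (γ ++ ⊗ as ∷ δ) a) λ f → precomp γ as δ f ≈ g
      rep-inj   : ∀ γ as δ {a} (f g : Hom (γ ++ ⊗ as ∷ δ) a) →
                  precomp γ as δ f ≈ precomp γ as δ g → f ≈ g

module _ {o h e o' h' e'} (M : MultiData o h e) (N : MultiData o' h' e') where
  private
    module M = MultiData M
    module N = MultiData N
    module MO = MOps M
    module NO = MOps N

  mapHL : (F₀ : M.Obj → N.Obj) →
          (F₁ : ∀ {Γ a} → M.Hom Γ a → N.Hom (map F₀ Γ) (F₀ a)) →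
          ∀ {Γ as} → MO.HomList Γ as → NO.HomList (map F₀ Γ) (map F₀ as)
  mapHL F₀ F₁ MO.[] = NO.[]
  mapHL F₀ F₁ (MO._∷_ {Γ} {Δ} f fs) =
    NO.castL (sym (map-++ F₀ Γ Δ)) (F₁ f NO.∷ mapHL F₀ F₁ fs)

  record RepFunctor : Set (o ⊔ h ⊔ e ⊔ o' ⊔ h' ⊔ e') where
    field
      F₀    : M.Obj → N.Obj
      F₁    : ∀ {Γ a} → M.Hom Γ a → N.Hom (map F₀ Γ) (F₀ a)
      F-cong : ∀ {Γ a} {f g : M.Hom Γ a} → f M.≈ g → F₁ f N.≈ F₁ g
      F-id  : ∀ a → F₁ (M.id a) N.≈ N.id (F₀ a)
      F-∘   : ∀ {Γ as b} (f : M.Hom as b) (fs : MO.HomList Γ as) →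
              F₁ (f M.∘ fs) N.≈ (F₁ f N.∘ mapHL F₀ F₁ fs)
      F-⊗   : ∀ as → F₀ (M.⊗ as) ≡ N.⊗ (map F₀ as)
      F-re  : ∀ as → subst (N.Hom (map F₀ as)) (F-⊗ as) (F₁ (M.re as))
                     N.≈ N.re (map F₀ as)

castH : ∀ {x o h e} {X : Set x} (N : MultiData o h e)
        {f g : X → MultiData.Obj N} → (∀ a → f a ≡ g a) →
        ∀ {Γ a} → MultiData.Hom N (map f Γ) (f a) → MultiData.Hom N (map g Γ) (g a)
castH N {f} {g} eq {Γ} {a} = subst₂ (MultiData.Hom N) (map-cong eq Γ) (eq a)

data Ty (A : Set) : Set where
  atom   : A → Ty A
  tensor : List (Ty A) → Ty A

Signature : Set → Set₁
Signature A = List (Ty A) → Ty A → Set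

record SigMap {o h e} (A : Set) (R : Signature A) (S : MultiData o h e)
       : Set (o ⊔ h) where
  open MultiData S
  field
    i₀   : Ty A → Obj
    i₀-⊗ : ∀ as → i₀ (tensor as) ≡ ⊗ (map i₀ as)
    i₁   : ∀ {as b} → R as b → Hom (map i₀ as) (i₀ b)

-- Representable terms (planar linear, nameless: a term in context
-- x₁:a₁,…,xₙ:aₙ uses its variables exactly once, in this order).

module Free (A : Set) (R : Signature A) where

  T = Ty A

  data Term : List T → T → Set where
    var  : ∀ {a} → Term [ a ] a
    app  : ∀ {Γ as b} → R as b → HomLists.HomList Term Γ as → Term Γ b
    tup  : ∀ {Γ as} → HomLists.HomList Term Γ as → Term Γ (tensor as)
    -- s[x⃗ := t]  with  δ,x⃗,δ' ⊢ s : b  and  γ ⊢ t : (a₁⊗…⊗aₖ)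
    letT : ∀ {as γ b} (δ δ' : List T) → Term (δ ++ as ++ δ') b →
           Term γ (tensor as) → Term (δ ++ γ ++ δ') b

  open HomLists Term public renaming (HomList to Terms)

  castT : ∀ {Γ Γ' a} → Γ ≡ Γ' → Term Γ a → Term Γ' a
  castT {a = a} eq = subst (λ G → Term G a) eq

  vars : ∀ as → Terms as as
  vars []       = []
  vars (a ∷ as) = var ∷ vars as

  sub  : ∀ {Γ Δ b} → Term Δ b → Terms Γ Δ → Term Γ b
  sub* : ∀ {Γ Δ bs} → Terms Δ bs → Terms Γ Δ → Terms Γ bs
  sub var (_∷_ {Γa} t []) = castT (sym (++-identityʳ Γa)) t
  sub (app f ss) ts = app f (sub* ss ts)
  sub (tup ss) ts = tup (sub* ss ts)
  sub (letT {as} {γ} δ δ' s t) ts with split δ (γ ++ δ') ts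
  ... | Γ₁ , Γr , eq₁ , ts₁ , tsr with split γ δ' tsr
  ... | Γ₂ , Γ₃ , eq₂ , ts₂ , ts₃ =
    castT (sym (trans eq₁ (cong (Γ₁ ++_) eq₂)))
      (letT Γ₁ Γ₃ (sub s (ts₁ ++H (vars as ++H ts₃))) (sub t ts₂))
  sub* [] [] = []
  sub* (_∷_ {Δ₁} {Δ₂} s ss) ts with split Δ₁ Δ₂ ts
  ... | Γ₁ , Γ₂ , eq , ts₁ , ts₂ = castL (sym eq) (sub s ts₁ ∷ sub* ss ts₂)

  data Ctx (Θ : List T) (a : T) : List T → T → Set where
    hole      : Ctx Θ a Θ a
    tupC      : ∀ {S₁ S₂ Γ as₁ as₂ b} → Terms S₁ as₁ → Ctx Θ a Γ b →
                Terms S₂ as₂ → Ctx Θ a (S₁ ++ Γ ++ S₂) (tensor (as₁ ++ b ∷ as₂))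
    appC      : ∀ {S₁ S₂ Γ as₁ as₂ b c} → R (as₁ ++ b ∷ as₂) c →
                Terms S₁ as₁ → Ctx Θ a Γ b → Terms S₂ as₂ →
                Ctx Θ a (S₁ ++ Γ ++ S₂) c
    letBodyC  : ∀ {as γ b} (δ δ' : List T) → Ctx Θ a (δ ++ as ++ δ') b →
                Term γ (tensor as) → Ctx Θ a (δ ++ γ ++ δ') b
    letBoundC : ∀ {as γ b} (δ δ' : List T) → Term (δ ++ as ++ δ') b →
                Ctx Θ a γ (tensor as) → Ctx Θ a (δ ++ γ ++ δ') b

  plug : ∀ {Θ a Γ b} → Ctx Θ a Γ b → Term Θ a → Term Γ b
  plug hole u = u
  plug (tupC ss₁ C ss₂) u = tup (ss₁ ++H (plug C u ∷ ss₂))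
  plug (appC f ss₁ C ss₂) u = app f (ss₁ ++H (plug C u ∷ ss₂))
  plug (letBodyC δ δ' C t) u = letT δ δ' (plug C u) t
  plug (letBoundC δ δ' s C) u = letT δ δ' s (plug C u)

  castC : ∀ {Θ a Γ Γ' b} → Γ ≡ Γ' → Ctx Θ a Γ b → Ctx Θ a Γ' b
  castC {Θ} {a} {b = b} eq = subst (λ G → Ctx Θ a G b) eq

  -- E-contexts: as C-contexts, but the hole may not be directly the
  -- let-bound term  s[x⃗ := [·]]
  NonHole : ∀ {Θ a Γ b} → Ctx Θ a Γ b → Set
  NonHole hole = ⊥
  NonHole _    = ⊤

  IsE : ∀ {Θ a Γ b} → Ctx Θ a Γ b → Set
  IsE hole                  = ⊤
  IsE (tupC _ C _)          = IsE C
  IsE (appC _ _ C _)        = IsE C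
  IsE (letBodyC _ _ C _)    = IsE C
  IsE (letBoundC _ _ _ C)   = IsE C × NonHole C

  -- Contexts binding no variable of a middle segment μ of the hole:
  -- PCtx δ δ' a Γl Γr b  instantiates, for every μ, to a context with
  -- hole context δ,μ,δ' and outer context Γl,μ,Γr (μ passes through).

  data PCtx (δ δ' : List T) (a : T) : List T → List T → T → Set where
    phole      : PCtx δ δ' a δ δ' a
    ptup       : ∀ {S₁ S₂ Γl Γr as₁ as₂ b} → Terms S₁ as₁ →
                 PCtx δ δ' a Γl Γr b → Terms S₂ as₂ →
                 PCtx δ δ' a (S₁ ++ Γl) (Γr ++ S₂) (tensor (as₁ ++ b ∷ as₂))
    papp       : ∀ {S₁ S₂ Γl Γr as₁ as₂ b c} → R (as₁ ++ b ∷ as₂) c →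
                 Terms S₁ as₁ → PCtx δ δ' a Γl Γr b → Terms S₂ as₂ →
                 PCtx δ δ' a (S₁ ++ Γl) (Γr ++ S₂) c
    pletBodyL  : ∀ {Γr as γ b} (σ ρ : List T) →
                 PCtx δ δ' a (σ ++ as ++ ρ) Γr b → Term γ (tensor as) →
                 PCtx δ δ' a (σ ++ γ ++ ρ) Γr b
    pletBodyR  : ∀ {Γl as γ b} (σ ρ : List T) →
                 PCtx δ δ' a Γl (σ ++ as ++ ρ) b → Term γ (tensor as) →
                 PCtx δ δ' a Γl (σ ++ γ ++ ρ) b
    pletBound  : ∀ {Γl Γr as b} (σ σ' : List T) → Term (σ ++ as ++ σ') b →
                 PCtx δ δ' a Γl Γr (tensor as) →
                 PCtx δ δ' a (σ ++ Γl) (Γr ++ σ') b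

  inst : ∀ {δ δ' a Γl Γr b} → PCtx δ δ' a Γl Γr b → (μ : List T) →
         Ctx (δ ++ μ ++ δ') a (Γl ++ μ ++ Γr) b
  inst phole μ = hole
  inst (ptup {S₁} {S₂} {Γl} {Γr} ss₁ P ss₂) μ =
    castC (reassoc S₁ Γl μ Γr S₂) (tupC ss₁ (inst P μ) ss₂)
  inst (papp {S₁} {S₂} {Γl} {Γr} f ss₁ P ss₂) μ =
    castC (reassoc S₁ Γl μ Γr S₂) (appC f ss₁ (inst P μ) ss₂)
  inst (pletBodyL {Γr} {as} {γ} σ ρ P t) μ =
    castC (sym (reassoc [] σ γ ρ (μ ++ Γr)))
      (letBodyC σ (ρ ++ μ ++ Γr)
        (castC (reassoc [] σ as ρ (μ ++ Γr)) (inst P μ)) t)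
  inst (pletBodyR {Γl} {as} {γ} σ ρ P t) μ =
    castC (sym (reassoc₂ Γl μ σ (γ ++ ρ)))
      (letBodyC (Γl ++ μ ++ σ) ρ
        (castC (reassoc₂ Γl μ σ (as ++ ρ)) (inst P μ)) t)
  inst (pletBound {Γl} {Γr} σ σ' s P) μ =
    castC (reassoc σ Γl μ Γr σ') (letBoundC σ σ' s (inst P μ))

  data LCtx (Θ : List T) : List T → Set where
    lhole : LCtx Θ Θ
    llet  : ∀ {as γ} (σ ρ : List T) → LCtx Θ (σ ++ as ++ ρ) →
            Term γ (tensor as) → LCtx Θ (σ ++ γ ++ ρ)

  plugL : ∀ {Θ Γ b} → LCtx Θ Γ → Term Θ b → Term Γ b
  plugL lhole u = u
  plugL (llet σ ρ L t) u = letT σ ρ (plugL L u) t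

  plugLF : ∀ {Θ Γ b} (δ δ' : List T) → LCtx Θ Γ →
           Term (δ ++ Θ ++ δ') b → Term (δ ++ Γ ++ δ') b
  plugLF δ δ' lhole u = u
  plugLF δ δ' (llet {as} {γ} σ ρ L t) u =
    castT (sym (reassoc δ σ γ ρ δ'))
      (letT (δ ++ σ) (ρ ++ δ')
        (castT (reassoc δ σ as ρ δ') (plugLF δ δ' L u)) t)

  IsLT : ∀ {Γ as} → Term Γ (tensor as) → Set
  IsLT {Γ} {as} s =
    Σ (List T) λ Θ → Σ (LCtx Θ Γ) λ L → Σ (Terms Θ as) λ ss →
      s ≡ plugL L (tup ss)

  etaExp : ∀ {Γ as} → Term Γ (tensor as) → Term Γ (tensor as)
  etaExp {Γ} {as} s =
    castT (++-identityʳ Γ)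
      (letT [] [] (castT (sym (++-identityʳ as)) (tup (vars as))) s)

  data Ax : ∀ {Γ a} → Term Γ a → Term Γ a → Set where
    -- structural equivalence  C[s[x⃗:=t]] ≡ C[s][x⃗:=t]
    float : ∀ {δ δ' b Γl Γr c as γ} (P : PCtx δ δ' b Γl Γr c)
            (s : Term (δ ++ as ++ δ') b) (t : Term γ (tensor as)) →
            Ax (plug (inst P γ) (letT δ δ' s t))
               (letT Γl Γr (plug (inst P as) s) t)
    beta  : ∀ {δ δ' as Θ γ b} (s : Term (δ ++ as ++ δ') b)
            (L : LCtx Θ γ) (ts : Terms Θ as) →
            Ax (letT δ δ' s (plugL L (tup ts)))
               (plugLF δ δ' L (sub s (vars δ ++H (ts ++H vars δ'))))

  data Step : ∀ {Γ a} → Term Γ a → Term Γ a → Set where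
    ctx : ∀ {Θ a Γ b} (C : Ctx Θ a Γ b) {s s' : Term Θ a} →
          Ax s s' → Step (plug C s) (plug C s')
    eta : ∀ {Θ as Γ b} (E : Ctx Θ (tensor as) Γ b) → IsE E →
          {s : Term Θ (tensor as)} → ¬ IsLT s →
          Step (plug E s) (plug E (etaExp s))

  _∼_ : ∀ {Γ a} → Term Γ a → Term Γ a → Set
  _∼_ = EqClosure Step

  gen : ∀ {as b} → R as b → Term as b
  gen {as} f = app f (vars as)

-- The free representable multicategory F(R) (its data; hom-setoids are
-- terms modulo ∼).
FR : (A : Set) → Signature A → MultiData 0ℓ 0ℓ 0ℓ
FR A R = record
  { Obj = Ty A
  ; Hom = Term
  ; _≈_ = _∼_
  ; id  = λ a → var
  ; _∘_ = sub
  ; ⊗   = tensor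
  ; re  = λ as → tup (vars as)
  }
  where open Free A R

module Submission where

-- Terms are interpreted in S by structural recursion: a variable as an identity,
-- f(s⃗) as i(f) ∘ ⟦s⃗⟧, ⟨s⃗⟩ as re ∘ ⟦s⃗⟧, and s[x⃗ := t] as ⟦t⟧ plugged into the
-- block x⃗ of the lift of ⟦s⟧, i.e. of the unique map whose precomposition with re
-- at that block is ⟦s⟧. Substitution becomes composition, and each generator of ∼
-- (floating a let through a context, β, η) holds in S because every map involved is
-- determined by its precomposition with re; hence ⟦−⟧ is a representable functor
-- F(R) → S extending i. Conversely, let a representable G agree with i on
-- generators. Every term is obtained by substituting subterms into f(x⃗), ⟨x⃗⟩ or
-- s[x⃗ := z], and G(s[x⃗ := z]) is forced to be the lift of G(s), because its
-- precomposition with re is G(s[x⃗ := ⟨x⃗⟩]) = G(s) by β. So G agrees with ⟦−⟧.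

open import Defs
open import Level using (Level; _⊔_)
open import Data.List using (List; []; _∷_; _++_; map)
open import Data.List.Properties using (++-assoc; ++-identityʳ; map-++; map-cong)
open import Data.Product using (Σ; _×_; _,_; proj₁; proj₂)
open import Relation.Binary.PropositionalEquality
  using (_≡_; refl; sym; trans; cong; cong₂; subst; subst₂)
open import Relation.Binary.Structures using (IsEquivalence)
open import Relation.Binary.Construct.Closure.ReflexiveTransitive using (ε; _◅_)
open import Relation.Binary.Construct.Closure.Symmetric using (fwd; bwd)
open import Axiom.UniquenessOfIdentityProofs.WithK using (uip)

module HomListProperties {o h} {Obj : Set o} (Hom : List Obj → Obj → Set h) where
  open HomLists Hom

  ∷-++H : ∀ {Γ Δ Γc a as cs} (f : Hom Γ a) (fs : HomList Δ as) (ks : HomList Γc cs) →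
          (f ∷ fs) ++H ks ≡ castL (sym (++-assoc Γ Δ Γc)) (f ∷ (fs ++H ks))
  ∷-++H f fs [] = refl
  ∷-++H f fs (g ∷ gs) = refl

  castL-trans : ∀ {Γ Γ' Γ'' as} (p : Γ ≡ Γ') (q : Γ' ≡ Γ'') (hs : HomList Γ as) →
                castL q (castL p hs) ≡ castL (trans p q) hs
  castL-trans refl refl hs = refl

  castL-refl : ∀ {Γ as} (p : Γ ≡ Γ) (hs : HomList Γ as) → castL p hs ≡ hs
  castL-refl refl hs = refl

  SplitRes : List Obj → List Obj → List Obj → Set (o ⊔ h)
  SplitRes as bs Γ = Σ (List Obj) λ Γ₁ → Σ (List Obj) λ Γ₂ →
            (Γ ≡ Γ₁ ++ Γ₂) × HomList Γ₁ as × HomList Γ₂ bs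

  SplitRes-cast : ∀ {as bs Γ Γ'} → Γ ≡ Γ' → SplitRes as bs Γ → SplitRes as bs Γ'
  SplitRes-cast e (G1 , G2 , eq , h1 , h2) = G1 , G2 , trans (sym e) eq , h1 , h2

  split-castL : ∀ as bs {Γ Γ'} (e : Γ ≡ Γ') (hs : HomList Γ (as ++ bs)) →
                split as bs (castL e hs) ≡ SplitRes-cast e (split as bs hs)
  split-castL as bs refl hs = refl

  split-++H : ∀ {Γ₁ Γ₂ as bs} (hs : HomList Γ₁ as) (ks : HomList Γ₂ bs) →
              split as bs (hs ++H ks) ≡ (Γ₁ , Γ₂ , refl , hs , ks)
  split-++H [] ks = refl
  split-++H {as = a ∷ as} {bs} (_∷_ {Γa} {Δ} f fs) ks
    rewrite ∷-++H f fs ks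
          | split-castL (a ∷ as) bs (sym (++-assoc Γa Δ _)) (f ∷ (fs ++H ks))
          | split-++H fs ks
    = cong (λ e → (_ , _ , e , f ∷ fs , ks)) (uip _ _)

  data SplitView (as bs : List Obj) : ∀ {Γ} → HomList Γ (as ++ bs) → Set (o ⊔ h) where
    sv : ∀ {Γ₁ Γ₂ Γ} (e : Γ₁ ++ Γ₂ ≡ Γ) (h1 : HomList Γ₁ as) (h2 : HomList Γ₂ bs) →
         SplitView as bs (castL e (h1 ++H h2))

  splitView : ∀ as bs {Γ} (hs : HomList Γ (as ++ bs)) → SplitView as bs hs
  splitView [] bs hs = sv refl [] hs
  splitView (a ∷ as) bs (_∷_ {Γa} f fs) with splitView as bs fs
  ... | sv {Γ₁} {Γ₂} refl h1 h2 =
    subst (SplitView (a ∷ as) bs) cons-view (sv (++-assoc Γa Γ₁ Γ₂) (f ∷ h1) h2)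
    where
    cons-view : castL (++-assoc Γa Γ₁ Γ₂) ((f ∷ h1) ++H h2) ≡ f ∷ (h1 ++H h2)
    cons-view = trans (cong (castL (++-assoc Γa Γ₁ Γ₂)) (∷-++H f h1 h2))
          (trans (castL-trans (sym (++-assoc Γa Γ₁ Γ₂)) (++-assoc Γa Γ₁ Γ₂) (f ∷ (h1 ++H h2)))
                 (castL-refl _ _))

  -- Index lists built with ++ agree only propositionally, so lists of morphisms are
  -- compared together with a proof that their indices agree.
  infix 4 _≐_
  _≐_ : ∀ {Γ Γ' as as'} → HomList Γ as → HomList Γ' as' → Set (o ⊔ h)
  _≐_ {Γ} {Γ'} {as} {as'} xs ys =
    Σ (Γ ≡ Γ') λ p → Σ (as ≡ as') λ q → subst₂ HomList p q xs ≡ ys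

  ≐-refl : ∀ {Γ as} {xs : HomList Γ as} → xs ≐ xs
  ≐-refl = refl , refl , refl

  ≡→≐ : ∀ {Γ as} {xs ys : HomList Γ as} → xs ≡ ys → xs ≐ ys
  ≡→≐ e = refl , refl , e

  ≐-sym : ∀ {Γ Γ' as as'} {xs : HomList Γ as} {ys : HomList Γ' as'} → xs ≐ ys → ys ≐ xs
  ≐-sym (refl , refl , refl) = refl , refl , refl

  infixr 2 _⟫≐_
  _⟫≐_ : ∀ {Γ Γ' Γ'' as as' as''} {xs : HomList Γ as} {ys : HomList Γ' as'}
         {zs : HomList Γ'' as''} → xs ≐ ys → ys ≐ zs → xs ≐ zs
  (refl , refl , refl) ⟫≐ (refl , refl , refl) = refl , refl , refl

  ≐→≡ : ∀ {Γ as} {xs ys : HomList Γ as} → xs ≐ ys → xs ≡ ys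
  ≐→≡ (refl , refl , e) = e

  castL-≐ : ∀ {Γ Γ' as} (e : Γ ≡ Γ') (xs : HomList Γ as) → castL e xs ≐ xs
  castL-≐ refl xs = ≐-refl

  ∷-cong≐ : ∀ {Γ Δ Δ' a as as'} (f : Hom Γ a) {xs : HomList Δ as} {ys : HomList Δ' as'} →
            xs ≐ ys → (f ∷ xs) ≐ (f ∷ ys)
  ∷-cong≐ f (refl , refl , refl) = ≐-refl

  ++H-cong≐ : ∀ {Γ₁ Γ₁' Γ₂ Γ₂' as as' bs bs'} {xs : HomList Γ₁ as} {xs' : HomList Γ₁' as'}
              {ys : HomList Γ₂ bs} {ys' : HomList Γ₂' bs'} →
              xs ≐ xs' → ys ≐ ys' → (xs ++H ys) ≐ (xs' ++H ys')
  ++H-cong≐ (refl , refl , refl) (refl , refl , refl) = ≐-refl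

  ∷-++H≐ : ∀ {Γ Δ Γc a as cs} (f : Hom Γ a) (fs : HomList Δ as) (ks : HomList Γc cs) →
           ((f ∷ fs) ++H ks) ≐ (f ∷ (fs ++H ks))
  ∷-++H≐ f fs ks = ≡→≐ (∷-++H f fs ks) ⟫≐ castL-≐ _ _

  ++H-assoc≐ : ∀ {Γ₁ Γ₂ Γ₃ as bs cs} (xs : HomList Γ₁ as) (ys : HomList Γ₂ bs)
               (zs : HomList Γ₃ cs) → ((xs ++H ys) ++H zs) ≐ (xs ++H (ys ++H zs))
  ++H-assoc≐ [] ys zs = ≐-refl
  ++H-assoc≐ (f ∷ fs) ys zs =
    ++H-cong≐ (∷-++H≐ f fs ys) (≐-refl {xs = zs})
    ⟫≐ ∷-++H≐ f (fs ++H ys) zs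
    ⟫≐ ∷-cong≐ f (++H-assoc≐ fs ys zs)
    ⟫≐ ≐-sym (∷-++H≐ f fs (ys ++H zs))


module CompositionProperties {o h e} (M : MultiData o h e) where
  open MultiData M
  open MOps M
  open HomListProperties Hom

  ∷-∘*-++H : ∀ {Γ₁ Γ₂ Δ₁ Δ₂ b bs} (f : Hom Δ₁ b) (fs : HomList Δ₂ bs)
          (h₁ : HomList Γ₁ Δ₁) (h₂ : HomList Γ₂ Δ₂) →
          (f ∷ fs) ∘* (h₁ ++H h₂) ≡ (f ∘ h₁) ∷ (fs ∘* h₂)
  ∷-∘*-++H {Δ₁ = Δ₁} {Δ₂} f fs h₁ h₂ rewrite split-++H h₁ h₂ = refl

  ∘*-cong≐ : ∀ {Γ Γ' Δ Δ' bs bs'} {fs : HomList Δ bs} {fs' : HomList Δ' bs'}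
             {hs : HomList Γ Δ} {hs' : HomList Γ' Δ'} →
             fs ≐ fs' → hs ≐ hs' → (fs ∘* hs) ≐ (fs' ∘* hs')
  ∘*-cong≐ (refl , refl , refl) (refl , refl , refl) = ≐-refl

  ++H-∘*-++H : ∀ {Γ₁ Γ₂ σ τ α β} (A : HomList σ α) (C : HomList τ β)
       (H₁ : HomList Γ₁ σ) (H₂ : HomList Γ₂ τ) →
       ((A ++H C) ∘* (H₁ ++H H₂)) ≐ ((A ∘* H₁) ++H (C ∘* H₂))
  ++H-∘*-++H [] C [] H₂ = ≐-refl
  ++H-∘*-++H (_∷_ {Δa} {ΔA} a A) C H₁ H₂ with splitView Δa ΔA H₁
  ... | sv refl Ha H₁' =
    ∘*-cong≐ (∷-++H≐ a A C) (++H-assoc≐ Ha H₁' H₂)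
    ⟫≐ ≡→≐ (∷-∘*-++H a (A ++H C) Ha (H₁' ++H H₂))
    ⟫≐ ∷-cong≐ (a ∘ Ha) (++H-∘*-++H A C H₁' H₂)
    ⟫≐ ≐-sym (∷-++H≐ (a ∘ Ha) (A ∘* H₁') (C ∘* H₂))
    ⟫≐ ++H-cong≐ (≐-sym (≡→≐ (∷-∘*-++H a A Ha H₁'))) (≐-refl {xs = C ∘* H₂})

module MapHLProperties {o h e o' h' e'} (M : MultiData o h e) (N : MultiData o' h' e')
       (F₀ : MultiData.Obj M → MultiData.Obj N)
       (F₁ : ∀ {Γ a} → MultiData.Hom M Γ a → MultiData.Hom N (map F₀ Γ) (F₀ a)) where
  open HomLists (MultiData.Hom N)
  open HomListProperties (MultiData.Hom N)
  private
    module M = MultiData M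
    module ML = HomLists M.Hom
    module MP = HomListProperties M.Hom

  mapF : ∀ {Γ as} → ML.HomList Γ as → HomList (map F₀ Γ) (map F₀ as)
  mapF = mapHL M N F₀ F₁

  mapHL-∷ : ∀ {Γ Δ a as} (f : M.Hom Γ a) (fs : ML.HomList Δ as) →
            mapF (f ML.∷ fs) ≐ (F₁ f ∷ mapF fs)
  mapHL-∷ f fs = castL-≐ _ _

  mapHL-castL : ∀ {Γ Γ' as} (p : Γ ≡ Γ') (fs : ML.HomList Γ as) → mapF (ML.castL p fs) ≐ mapF fs
  mapHL-castL refl fs = ≐-refl

  mapHL-++H : ∀ {Γ₁ Γ₂ as bs} (fs : ML.HomList Γ₁ as) (gs : ML.HomList Γ₂ bs) →
              mapF (fs ML.++H gs) ≐ (mapF fs ++H mapF gs)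
  mapHL-++H ML.[] gs = ≐-refl
  mapHL-++H (ML._∷_ {Γ} {Δ} f fs) gs =
    ≡→≐ (cong mapF (MP.∷-++H f fs gs))
    ⟫≐ mapHL-castL (sym (++-assoc Γ Δ _)) (f ML.∷ (fs ML.++H gs))
    ⟫≐ mapHL-∷ f (fs ML.++H gs)
    ⟫≐ ∷-cong≐ (F₁ f) (mapHL-++H fs gs)
    ⟫≐ ≐-sym (∷-++H≐ (F₁ f) (mapF fs) (mapF gs))
    ⟫≐ ++H-cong≐ (≐-sym (mapHL-∷ f fs)) (≐-refl {xs = mapF gs})

module MulticategoryProperties {o h e} (S : MultiData o h e) (isRep : IsRepMulticategory S) where
  open MultiData S
  open MOps S
  open HomListProperties Hom
  open CompositionProperties S
  open IsRepMulticategory isRep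

  ≈-refl : ∀ {Γ a} {f : Hom Γ a} → f ≈ f
  ≈-refl = IsEquivalence.refl ≈-equiv

  ≈-sym : ∀ {Γ a} {f g : Hom Γ a} → f ≈ g → g ≈ f
  ≈-sym = IsEquivalence.sym ≈-equiv

  ≈-trans : ∀ {Γ a} {f g k : Hom Γ a} → f ≈ g → g ≈ k → f ≈ k
  ≈-trans = IsEquivalence.trans ≈-equiv

  ≈*-refl : ∀ {Γ as} {xs : HomList Γ as} → xs ≈* xs
  ≈*-refl {xs = []} = []
  ≈*-refl {xs = f ∷ fs} = ≈-refl ∷ ≈*-refl

  ≈*-sym : ∀ {Γ as} {xs ys : HomList Γ as} → xs ≈* ys → ys ≈* xs
  ≈*-sym [] = []
  ≈*-sym (p ∷ ps) = ≈-sym p ∷ ≈*-sym ps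

  ≈*-trans : ∀ {Γ as} {xs ys zs : HomList Γ as} → xs ≈* ys → ys ≈* zs → xs ≈* zs
  ≈*-trans [] [] = []
  ≈*-trans (p ∷ ps) (q ∷ qs) = ≈-trans p q ∷ ≈*-trans ps qs

  castL-cong≈* : ∀ {Γ Γ' as} (e : Γ ≡ Γ') {xs ys : HomList Γ as} → xs ≈* ys → castL e xs ≈* castL e ys
  castL-cong≈* refl p = p

  ++H-cong≈* : ∀ {Γ₁ Γ₂ as bs} {xs xs' : HomList Γ₁ as} {ys ys' : HomList Γ₂ bs} →
               xs ≈* xs' → ys ≈* ys' → (xs ++H ys) ≈* (xs' ++H ys')
  ++H-cong≈* [] q = q
  ++H-cong≈* {ys = ys} {ys'} (_∷_ {f = f} {f'} {fs} {fs'} p ps) q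
    rewrite ∷-++H f fs ys | ∷-++H f' fs' ys' = castL-cong≈* _ (p ∷ ++H-cong≈* ps q)


  infix 4 _≋_ _≋*_

  _≋_ : ∀ {Γ Γ' a a'} → Hom Γ a → Hom Γ' a' → Set (o ⊔ e)
  _≋_ {Γ} {Γ'} {a} {a'} f g = Σ (Γ ≡ Γ') λ p → Σ (a ≡ a') λ q → subst₂ Hom p q f ≈ g

  _≋*_ : ∀ {Γ Γ' as as'} → HomList Γ as → HomList Γ' as' → Set (o ⊔ h ⊔ e)
  _≋*_ {Γ} {Γ'} {as} {as'} xs ys =
    Σ (Γ ≡ Γ') λ p → Σ (as ≡ as') λ q → subst₂ HomList p q xs ≈* ys

  ≈→≋ : ∀ {Γ a} {f g : Hom Γ a} → f ≈ g → f ≋ g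
  ≈→≋ p = refl , refl , p

  ≋→≈ : ∀ {Γ a} {f g : Hom Γ a} → f ≋ g → f ≈ g
  ≋→≈ (refl , refl , p) = p

  ≋-refl : ∀ {Γ a} {f : Hom Γ a} → f ≋ f
  ≋-refl = ≈→≋ ≈-refl

  ≋-sym : ∀ {Γ Γ' a a'} {f : Hom Γ a} {g : Hom Γ' a'} → f ≋ g → g ≋ f
  ≋-sym (refl , refl , p) = refl , refl , ≈-sym p

  infixr 2 _⟫_ _⟫*_
  _⟫_ : ∀ {Γ Γ' Γ'' a a' a''} {f : Hom Γ a} {g : Hom Γ' a'} {k : Hom Γ'' a''} →
        f ≋ g → g ≋ k → f ≋ k
  (refl , refl , p) ⟫ (refl , refl , q) = refl , refl , ≈-trans p q

  ≡→≋ : ∀ {Γ a} {f g : Hom Γ a} → f ≡ g → f ≋ g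
  ≡→≋ refl = ≋-refl

  substL : ∀ {Γ Γ' a} → Γ ≡ Γ' → Hom Γ a → Hom Γ' a
  substL {a = a} p f = subst (λ G → Hom G a) p f

  subst₂-≋ : ∀ {Γ Γ' a a'} (p : Γ ≡ Γ') (q : a ≡ a') (f : Hom Γ a) → subst₂ Hom p q f ≋ f
  subst₂-≋ refl refl f = ≋-refl

  subst-≋ : ∀ {Γ a a'} (q : a ≡ a') (f : Hom Γ a) → subst (Hom Γ) q f ≋ f
  subst-≋ refl f = ≋-refl

  substL-≋ : ∀ {Γ Γ' a} (p : Γ ≡ Γ') (f : Hom Γ a) → substL p f ≋ f
  substL-≋ refl f = ≋-refl

  ≈*→≋* : ∀ {Γ as} {xs ys : HomList Γ as} → xs ≈* ys → xs ≋* ys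
  ≈*→≋* p = refl , refl , p

  ≋*→≈* : ∀ {Γ as} {xs ys : HomList Γ as} → xs ≋* ys → xs ≈* ys
  ≋*→≈* (refl , refl , p) = p

  ≋*-refl : ∀ {Γ as} {xs : HomList Γ as} → xs ≋* xs
  ≋*-refl = ≈*→≋* ≈*-refl

  ≋*-sym : ∀ {Γ Γ' as as'} {xs : HomList Γ as} {ys : HomList Γ' as'} → xs ≋* ys → ys ≋* xs
  ≋*-sym (refl , refl , p) = refl , refl , ≈*-sym p

  _⟫*_ : ∀ {Γ Γ' Γ'' as as' as''} {xs : HomList Γ as} {ys : HomList Γ' as'}
         {zs : HomList Γ'' as''} → xs ≋* ys → ys ≋* zs → xs ≋* zs
  (refl , refl , p) ⟫* (refl , refl , q) = refl , refl , ≈*-trans p q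

  ≡→≋* : ∀ {Γ as} {xs ys : HomList Γ as} → xs ≡ ys → xs ≋* ys
  ≡→≋* refl = ≋*-refl

  ≐→≋* : ∀ {Γ Γ' as as'} {xs : HomList Γ as} {ys : HomList Γ' as'} → xs ≐ ys → xs ≋* ys
  ≐→≋* (refl , refl , refl) = ≋*-refl

  ∘-cong≋ : ∀ {Γ Γ' as as' b b'} {f : Hom as b} {f' : Hom as' b'}
            {fs : HomList Γ as} {fs' : HomList Γ' as'} →
            f ≋ f' → fs ≋* fs' → (f ∘ fs) ≋ (f' ∘ fs')
  ∘-cong≋ (refl , refl , p) (refl , refl , q) = ≈→≋ (∘-cong p q)

  ∘-cong≋ˡ : ∀ {Γ as b} {f f' : Hom as b} (fs : HomList Γ as) → f ≈ f' → (f ∘ fs) ≋ (f' ∘ fs)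
  ∘-cong≋ˡ fs p = ∘-cong≋ (≈→≋ p) ≋*-refl

  ∘-cong≋ʳ : ∀ {Γ Γ' as b} (f : Hom as b) {fs : HomList Γ as} {fs' : HomList Γ' as} →
             fs ≋* fs' → (f ∘ fs) ≋ (f ∘ fs')
  ∘-cong≋ʳ f p = ∘-cong≋ ≋-refl p

  ∷-cong≋* : ∀ {Γ Γ' Δ Δ' a a' as as'} {f : Hom Γ a} {f' : Hom Γ' a'}
             {xs : HomList Δ as} {ys : HomList Δ' as'} →
             f ≋ f' → xs ≋* ys → (f ∷ xs) ≋* (f' ∷ ys)
  ∷-cong≋* (refl , refl , p) (refl , refl , q) = refl , refl , (p ∷ q)

  ++H-cong≋* : ∀ {Γ₁ Γ₁' Γ₂ Γ₂' as as' bs bs'} {xs : HomList Γ₁ as} {xs' : HomList Γ₁' as'}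
               {ys : HomList Γ₂ bs} {ys' : HomList Γ₂' bs'} →
               xs ≋* xs' → ys ≋* ys' → (xs ++H ys) ≋* (xs' ++H ys')
  ++H-cong≋* (refl , refl , p) (refl , refl , q) = refl , refl , ++H-cong≈* p q

  castL-≋* : ∀ {Γ Γ' as} (e : Γ ≡ Γ') (xs : HomList Γ as) → castL e xs ≋* xs
  castL-≋* e xs = ≐→≋* (castL-≐ e xs)

  idsL-++ : ∀ x y → idsL (x ++ y) ≡ idsL x ++H idsL y
  idsL-++ [] y = refl
  idsL-++ (a ∷ x) y = trans (cong (id a ∷_) (idsL-++ x y))
                           (≐→≡ (≐-sym (∷-++H≐ (id a) (idsL x) (idsL y))))

  id-∘-∷[] : ∀ {Γ a} (f : Hom Γ a) → (id a ∘ (f ∷ [])) ≋ f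
  id-∘-∷[] {Γ} f = ∘-cong≋ʳ (id _) (≋*-sym (castL-≋* (++-identityʳ Γ) (f ∷ [])))
                       ⟫ ≈→≋ (id-left f)

  idsL-∘* : ∀ {Γ Δ} (hs : HomList Γ Δ) → (idsL Δ ∘* hs) ≋* hs
  idsL-∘* [] = ≋*-refl
  idsL-∘* (f ∷ fs) = castL-≋* _ _ ⟫* ∷-cong≋* (id-∘-∷[] f) (idsL-∘* fs)

  ∘*-idsL : ∀ {Δ bs} (fs : HomList Δ bs) → (fs ∘* idsL Δ) ≈* fs
  ∘*-idsL [] = []
  ∘*-idsL (_∷_ {Δ₁} {Δ₂} f fs) rewrite idsL-++ Δ₁ Δ₂ | ∷-∘*-++H f fs (idsL Δ₁) (idsL Δ₂) =
    id-right f ∷ ∘*-idsL fs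

  idsL-reassoc : ∀ σ γ γ' σ' {Γy y} (Y : Hom Γy y) →
             (idsL σ ++H ((idsL γ ++H (Y ∷ idsL γ')) ++H idsL σ')) ≐
             (idsL (σ ++ γ) ++H (Y ∷ idsL (γ' ++ σ')))
  idsL-reassoc σ γ γ' σ' Y =
    ++H-cong≐ (≐-refl {xs = idsL σ})
      (++H-assoc≐ (idsL γ) (Y ∷ idsL γ') (idsL σ')
       ⟫≐ ++H-cong≐ (≐-refl {xs = idsL γ}) (∷-++H≐ Y (idsL γ') (idsL σ')))
    ⟫≐ ≐-sym (++H-cong≐ (≡→≐ (idsL-++ σ γ)) (∷-cong≐ Y (≡→≐ (idsL-++ γ' σ')))
              ⟫≐ ++H-assoc≐ (idsL σ) (idsL γ) (Y ∷ (idsL γ' ++H idsL σ')))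

  idsL-≐ : ∀ {x y} → x ≡ y → idsL x ≐ idsL y
  idsL-≐ refl = ≐-refl

  ∘-interchange : ∀ {σ σ' α β ΓY ΓK ΓA ΓB b c} (g : Hom (α ++ b ∷ β) c) (A : HomList σ α)
        (Y : Hom ΓY b) (B : HomList σ' β) (HA : HomList ΓA σ) (K : HomList ΓK ΓY)
        (HB : HomList ΓB σ') →
        ((g ∘ (A ++H (Y ∷ B))) ∘ (HA ++H (K ++H HB))) ≈
        (g ∘ ((A ∘* HA) ++H ((Y ∘ K) ∷ (B ∘* HB))))
  ∘-interchange g A Y B HA K HB =
    ≈-trans (assoc g (A ++H (Y ∷ B)) (HA ++H (K ++H HB)))
      (∘-cong ≈-refl (≋*→≈* (≐→≋* (++H-∘*-++H A (Y ∷ B) HA (K ++H HB)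
         ⟫≐ ++H-cong≐ (≐-refl {xs = A ∘* HA}) (≡→≐ (∷-∘*-++H Y B K HB))))))


  castH-≋ : ∀ {x} {X : Set x} {f g : X → Obj} (eq : ∀ a → f a ≡ g a) {Γ a}
            (u : Hom (map f Γ) (f a)) → castH S eq u ≋ u
  castH-≋ eq u = subst₂-≋ _ _ u

  id-≋ : ∀ {a b} → a ≡ b → id a ≋ id b
  id-≋ refl = ≋-refl

  re-≋ : ∀ {as bs} → as ≡ bs → re as ≋ re bs
  re-≋ refl = ≋-refl


module LiftProperties {o h e} (S : MultiData o h e) (isRep : IsRepMulticategory S) where
  open MultiData S
  open MOps S
  open HomListProperties Hom
  open CompositionProperties S
  open IsRepMulticategory isRep
  open MulticategoryProperties S isRep

  -- The inverse, given by representability, of precomposition with re at the block as.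
  lift : ∀ δ as δ' {Γ c} → Γ ≡ δ ++ as ++ δ' → Hom Γ c → Hom (δ ++ ⊗ as ∷ δ') c
  lift δ as δ' {c = c} e f = proj₁ (rep-surj δ as δ' (subst (λ G → Hom G c) e f))

  reAt : ∀ δ as δ' → HomList (δ ++ as ++ δ') (δ ++ ⊗ as ∷ δ')
  reAt δ as δ' = idsL δ ++H (re as ∷ idsL δ')

  lift-∘-reAt : ∀ δ as δ' {Γ c} (e : Γ ≡ δ ++ as ++ δ') (f : Hom Γ c) →
              (lift δ as δ' e f ∘ reAt δ as δ') ≋ f
  lift-∘-reAt δ as δ' refl f = ≈→≋ (proj₂ (rep-surj δ as δ' f))

  lift-unique : ∀ δ as δ' {Γ Γu Θ c} (e : Γ ≡ δ ++ as ++ δ') (f : Hom Γ c) (u : Hom Γu c)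
                (HS : HomList Θ Γu) → HS ≐ reAt δ as δ' → (u ∘ HS) ≋ f →
                lift δ as δ' e f ≋ u
  lift-unique δ as δ' refl f u HS (refl , refl , refl) p =
    ≈→≋ (rep-inj δ as δ' _ u (≈-trans (proj₂ (rep-surj δ as δ' f)) (≋→≈ (≋-sym p))))

  lift-unique-≋* : ∀ δ as δ' {Γ Γu Θ c c'} (e : Γ ≡ δ ++ as ++ δ') (f : Hom Γ c) (u : Hom Γu c')
                 (HS : HomList Θ Γu) → HS ≋* reAt δ as δ' → (u ∘ HS) ≋ f →
                 lift δ as δ' e f ≋ u
  lift-unique-≋* δ as δ' e f u HS (refl , refl , r) (refl , refl , p) =
    lift-unique δ as δ' e f u (reAt δ as δ') ≐-refl
      (∘-cong≋ʳ u (≋*-sym (refl , refl , r)) ⟫ (refl , refl , p))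

  lift-cong : ∀ δ as δ' {Γ Γ' c} (e : Γ ≡ δ ++ as ++ δ') (e' : Γ' ≡ δ ++ as ++ δ')
              {f : Hom Γ c} {f' : Hom Γ' c} → f ≋ f' →
              lift δ as δ' e f ≈ lift δ as δ' e' f'
  lift-cong δ as δ' e e' {f} {f'} p =
    ≋→≈ (lift-unique δ as δ' e f _ (reAt δ as δ') ≐-refl
           (lift-∘-reAt δ as δ' e' f' ⟫ ≋-sym p))

  lift-cong≋ : ∀ δ as δ' {Γ Γ' c c'} (e : Γ ≡ δ ++ as ++ δ') (e' : Γ' ≡ δ ++ as ++ δ')
               {f : Hom Γ c} {f' : Hom Γ' c'} → f ≋ f' →
               lift δ as δ' e f ≋ lift δ as δ' e' f'
  lift-cong≋ δ as δ' e e' (refl , refl , p) = ≈→≋ (lift-cong δ as δ' e e' (≈→≋ p))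

  lift-cong-reindex : ∀ {δ₁ δ₂ δ₁' δ₂' as Γ Γ' c c'} (p : δ₁ ≡ δ₂) (q : δ₁' ≡ δ₂')
             (e : Γ ≡ δ₁ ++ as ++ δ₁') (e' : Γ' ≡ δ₂ ++ as ++ δ₂') {f : Hom Γ c} {f' : Hom Γ' c'} →
             f ≋ f' → lift δ₁ as δ₁' e f ≋ lift δ₂ as δ₂' e' f'
  lift-cong-reindex {δ₁} {_} {δ₁'} {_} {as} refl refl e e' p = lift-cong≋ δ₁ as δ₁' e e' p

  lift-∘-outer : ∀ {σ ρ Δ₁ Δ₂ as c Γ} (e : Γ ≡ σ ++ as ++ ρ) (g : Hom (Δ₁ ++ as ++ Δ₂) c)
        (H₁ : HomList σ Δ₁) (H₂ : HomList ρ Δ₂) (f : Hom Γ c) →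
        f ≋ (g ∘ (H₁ ++H (idsL as ++H H₂))) →
        lift σ as ρ e f ≋ (lift Δ₁ as Δ₂ refl g ∘ (H₁ ++H (id (⊗ as) ∷ H₂)))
  lift-∘-outer {σ} {ρ} {Δ₁} {Δ₂} {as} e g H₁ H₂ f pf =
    lift-unique σ as ρ e f u HS
      (++H-cong≐ (≐-refl {xs = idsL σ}) (∷-++H≐ (re as) [] (idsL ρ)))
      (≈→≋ (∘-interchange Lg H₁ (id (⊗ as)) H₂ (idsL σ) (re as ∷ []) (idsL ρ))
       ⟫ ∘-cong≋ʳ Lg (++H-cong≋* (≈*→≋* (∘*-idsL H₁))
                       (∷-cong≋* (id-∘-∷[] (re as)) (≈*→≋* (∘*-idsL H₂))))
       ⟫ ≋-sym (∘-cong≋ʳ Lg (++H-cong≋* (idsL-∘* H₁)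
                              (∷-cong≋* (≈→≋ (id-right (re as))) (idsL-∘* H₂))))
       ⟫ ≈→≋ (≈-sym (∘-interchange Lg (idsL Δ₁) (re as) (idsL Δ₂) H₁ (idsL as) H₂))
       ⟫ ∘-cong≋ˡ (H₁ ++H (idsL as ++H H₂)) (≋→≈ (lift-∘-reAt Δ₁ as Δ₂ refl g))
       ⟫ ≋-sym pf)
    where
    Lg = lift Δ₁ as Δ₂ refl g
    u = Lg ∘ (H₁ ++H (id (⊗ as) ∷ H₂))
    HS = idsL σ ++H ((re as ∷ []) ++H idsL ρ)

  lift-∘-inner : ∀ {σ σ' α β γ γ' as ΓX Γf b c} (g : Hom (α ++ b ∷ β) c) (A : HomList σ α)
        (eX : ΓX ≡ γ ++ as ++ γ') (X : Hom ΓX b) (B : HomList σ' β)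
        (e : Γf ≡ (σ ++ γ) ++ as ++ (γ' ++ σ')) (f : Hom Γf c) →
        f ≋ (g ∘ (A ++H (X ∷ B))) →
        lift (σ ++ γ) as (γ' ++ σ') e f ≋ (g ∘ (A ++H (lift γ as γ' eX X ∷ B)))
  lift-∘-inner {σ} {σ'} {α} {β} {γ} {γ'} {as} g A eX X B e f pf =
    lift-unique (σ ++ γ) as (γ' ++ σ') e f (g ∘ (A ++H (LX ∷ B)))
      (idsL σ ++H ((idsL γ ++H (re as ∷ idsL γ')) ++H idsL σ'))
      (idsL-reassoc σ γ γ' σ' (re as))
      (≈→≋ (∘-interchange g A LX B (idsL σ) (idsL γ ++H (re as ∷ idsL γ')) (idsL σ'))
       ⟫ ∘-cong≋ʳ g (++H-cong≋* (≈*→≋* (∘*-idsL A))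
                      (∷-cong≋* (lift-∘-reAt γ as γ' eX X) (≈*→≋* (∘*-idsL B))))
       ⟫ ≋-sym pf)
    where LX = lift γ as γ' eX X

  -- Both sides are characterised by precomposition with re at both blocks, which gives X.
  lift-lift : ∀ σ as ρ bs τ {Γ c} (X : Hom Γ c) (e₀ : Γ ≡ σ ++ as ++ (ρ ++ bs ++ τ))
       (e₁ : σ ++ ⊗ as ∷ (ρ ++ bs ++ τ) ≡ (σ ++ ⊗ as ∷ ρ) ++ bs ++ τ)
       (e₂ : Γ ≡ (σ ++ as ++ ρ) ++ bs ++ τ)
       (e₃ : (σ ++ as ++ ρ) ++ ⊗ bs ∷ τ ≡ σ ++ as ++ (ρ ++ ⊗ bs ∷ τ)) →
       lift (σ ++ ⊗ as ∷ ρ) bs τ e₁ (lift σ as (ρ ++ bs ++ τ) e₀ X) ≋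
       lift σ as (ρ ++ ⊗ bs ∷ τ) e₃ (lift (σ ++ as ++ ρ) bs τ e₂ X)
  lift-lift σ as ρ bs τ X e₀ e₁ e₂ e₃ =
    ≋-sym (lift-unique σ as (ρ ++ ⊗ bs ∷ τ) e₃ Y L₁ HS HS≐ p)
    where
    L₀ = lift σ as (ρ ++ bs ++ τ) e₀ X
    L₁ = lift (σ ++ ⊗ as ∷ ρ) bs τ e₁ L₀
    Y = lift (σ ++ as ++ ρ) bs τ e₂ X
    A' = idsL σ ++H (re as ∷ idsL ρ)
    HS = A' ++H (id (⊗ bs) ∷ idsL τ)
    HS' = reAt (σ ++ as ++ ρ) bs τ
    HS≐ : HS ≐ reAt σ as (ρ ++ ⊗ bs ∷ τ)
    HS≐ = ++H-assoc≐ (idsL σ) (re as ∷ idsL ρ) (id (⊗ bs) ∷ idsL τ)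
          ⟫≐ (++H-cong≐ (≐-refl {xs = idsL σ})
            (∷-++H≐ (re as) (idsL ρ) (id (⊗ bs) ∷ idsL τ)
              ⟫≐ ∷-cong≐ (re as) (≡→≐ (sym (idsL-++ ρ (⊗ bs ∷ τ))))))
    reAt∘*reAt : (HS ∘* HS') ≋* (A' ++H (re bs ∷ idsL τ))
    reAt∘*reAt = ≐→≋* ((∘*-cong≐ (≐-refl {xs = HS})
                  (++H-cong≐ (≐-refl {xs = idsL (σ ++ as ++ ρ)}) (≐-sym (∷-++H≐ (re bs) [] (idsL τ)))))
              ⟫≐ ++H-∘*-++H A' (id (⊗ bs) ∷ idsL τ) (idsL (σ ++ as ++ ρ)) ((re bs ∷ []) ++H idsL τ)
              ⟫≐ (++H-cong≐ (≐-refl {xs = A' ∘* idsL (σ ++ as ++ ρ)})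
                   (≡→≐ (∷-∘*-++H (id (⊗ bs)) (idsL τ) (re bs ∷ []) (idsL τ)))))
         ⟫* ++H-cong≋* (≈*→≋* (∘*-idsL A')) (∷-cong≋* (id-∘-∷[] (re bs)) (≈*→≋* (∘*-idsL (idsL τ))))
    X≋L₁∘re∘re : X ≋ (L₁ ∘ (A' ++H (re bs ∷ idsL τ)))
    X≋L₁∘re∘re =
      ≋-sym (lift-∘-reAt σ as (ρ ++ bs ++ τ) e₀ X)
      ⟫ ∘-cong≋ (≋-sym (lift-∘-reAt (σ ++ ⊗ as ∷ ρ) bs τ e₁ L₀))
          (≐→≋* (++H-cong≐ (≐-refl {xs = idsL σ})
                   (∷-cong≐ (re as) (≡→≐ (idsL-++ ρ (bs ++ τ))
                                     ⟫≐ ++H-cong≐ (≐-refl {xs = idsL ρ}) (≡→≐ (idsL-++ bs τ))))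
                 ⟫≐ ++H-cong≐ (≐-refl {xs = idsL σ})
                      (≐-sym (∷-++H≐ (re as) (idsL ρ) (idsL bs ++H idsL τ)))
                 ⟫≐ ≐-sym (++H-assoc≐ (idsL σ) (re as ∷ idsL ρ) (idsL bs ++H idsL τ))))
      ⟫ ≈→≋ (∘-interchange L₁ (idsL (σ ++ ⊗ as ∷ ρ)) (re bs) (idsL τ) A' (idsL bs) (idsL τ))
      ⟫ ∘-cong≋ʳ L₁ (++H-cong≋* (idsL-∘* A')
                      (∷-cong≋* (≈→≋ (id-right (re bs))) (≈*→≋* (∘*-idsL (idsL τ)))))
    q : ((L₁ ∘ HS) ∘ HS') ≋ X
    q = ≈→≋ (assoc L₁ HS HS') ⟫ ∘-cong≋ʳ L₁ reAt∘*reAt ⟫ ≋-sym X≋L₁∘re∘re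
    p : (L₁ ∘ HS) ≋ Y
    p = ≋-sym (lift-unique (σ ++ as ++ ρ) bs τ e₂ X (L₁ ∘ HS) HS' ≐-refl q)

  lift-∘-tuple : ∀ δ as δ' {Γg Θ ΓT Γf c} (g : Hom Γg c) (e : Γg ≡ δ ++ as ++ δ')
          (TS : HomList Θ as) (Tc : Hom ΓT (⊗ as)) (f : Hom Γf c) →
          Tc ≋ (re as ∘ TS) → f ≋ (substL e g ∘ (idsL δ ++H (TS ++H idsL δ'))) →
          (lift δ as δ' e g ∘ (idsL δ ++H (Tc ∷ idsL δ'))) ≋ f
  lift-∘-tuple δ as δ' g refl TS Tc f pT pf =
    ∘-cong≋ʳ Lg (++H-cong≋* (≋*-sym (≈*→≋* (∘*-idsL (idsL δ))))
                  (∷-cong≋* pT (≋*-sym (≈*→≋* (∘*-idsL (idsL δ'))))))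
    ⟫ ≈→≋ (≈-sym (∘-interchange Lg (idsL δ) (re as) (idsL δ') (idsL δ) TS (idsL δ')))
    ⟫ ∘-cong≋ (lift-∘-reAt δ as δ' refl g) ≋*-refl
    ⟫ ≋-sym pf
    where Lg = lift δ as δ' refl g

  -- Floating a let out of an argument position of g.
  float-inner-lift : ∀ {σA σB α β b c Γl Γr as Γt ΓX ΓX₁ Γ₁ Γ₂}
           (g : Hom (α ++ b ∷ β) c) (A : HomList σA α) (B : HomList σB β)
           (eX : ΓX ≡ Γl ++ as ++ Γr) (X : Hom ΓX b) (T : Hom Γt (⊗ as))
           (X₁ : Hom ΓX₁ b) (f₁ : Hom Γ₁ c) (f₂ : Hom Γ₂ c)
           (e₂ : Γ₂ ≡ (σA ++ Γl) ++ as ++ (Γr ++ σB)) →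
           f₁ ≋ (g ∘ (A ++H (X₁ ∷ B))) →
           X₁ ≋ (lift Γl as Γr eX X ∘ (idsL Γl ++H (T ∷ idsL Γr))) →
           f₂ ≋ (g ∘ (A ++H (X ∷ B))) →
           f₁ ≋ (lift (σA ++ Γl) as (Γr ++ σB) e₂ f₂ ∘ (idsL (σA ++ Γl) ++H (T ∷ idsL (Γr ++ σB))))
  float-inner-lift {σA} {σB} {Γl = Γl} {Γr} {as} g A B eX X T X₁ f₁ f₂ e₂ p₁ pX₁ p₂ =
    p₁
    ⟫ ∘-cong≋ʳ g (++H-cong≋* (≋*-sym (≈*→≋* (∘*-idsL A)))
                   (∷-cong≋* pX₁ (≋*-sym (≈*→≋* (∘*-idsL B)))))
    ⟫ ≈→≋ (≈-sym (∘-interchange g A (lift Γl as Γr eX X) B (idsL σA) (idsL Γl ++H (T ∷ idsL Γr)) (idsL σB)))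
    ⟫ ∘-cong≋ (≋-sym (lift-∘-inner g A eX X B e₂ f₂ p₂)) (≐→≋* (idsL-reassoc σA Γl Γr σB T))

  ++-assoc₃ : ∀ (x y z w : List Obj) → (x ++ y ++ z) ++ w ≡ x ++ y ++ (z ++ w)
  ++-assoc₃ x y z w = trans (++-assoc x (y ++ z) w) (cong (x ++_) (++-assoc y z w))

  -- Two nested lets on disjoint blocks commute: both sides reduce to a double lift of X
  -- precomposed with Tt' and Tt, and the two double lifts agree by lift-lift.
  lift-∘-lift-∘-comm : ∀ σ as' ρ as Γr γ γ' {Γ₁ Γ₂ ΓW1 ΓW2 ΓX c} (X : Hom ΓX c)
        (eX : ΓX ≡ (σ ++ as' ++ ρ) ++ as ++ Γr) (eX' : ΓX ≡ σ ++ as' ++ (ρ ++ as ++ Γr))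
        (Tt : Hom γ (⊗ as)) (Tt' : Hom γ' (⊗ as'))
        (W1 : Hom ΓW1 c) (e₁ : ΓW1 ≡ σ ++ as' ++ (ρ ++ γ ++ Γr))
        (W2 : Hom ΓW2 c) (e₂ : ΓW2 ≡ (σ ++ γ' ++ ρ) ++ as ++ Γr)
        (f₁ : Hom Γ₁ c) (f₂ : Hom Γ₂ c) →
        f₁ ≋ (lift σ as' (ρ ++ γ ++ Γr) e₁ W1 ∘ (idsL σ ++H (Tt' ∷ idsL (ρ ++ γ ++ Γr)))) →
        W1 ≋ (lift (σ ++ as' ++ ρ) as Γr eX X ∘ (idsL (σ ++ as' ++ ρ) ++H (Tt ∷ idsL Γr))) →
        f₂ ≋ (lift (σ ++ γ' ++ ρ) as Γr e₂ W2 ∘ (idsL (σ ++ γ' ++ ρ) ++H (Tt ∷ idsL Γr))) →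
        W2 ≋ (lift σ as' (ρ ++ as ++ Γr) eX' X ∘ (idsL σ ++H (Tt' ∷ idsL (ρ ++ as ++ Γr)))) →
        f₁ ≋ f₂
  lift-∘-lift-∘-comm σ as' ρ as Γr γ γ' X eX eX' Tt Tt' W1 e₁ W2 e₂ f₁ f₂ p₁ pW1 p₂ pW2 =
    f₁≋LL₂∘Ts ⟫ ≋-sym f₂≋LL₂∘Ts
    where
    LX = lift (σ ++ as' ++ ρ) as Γr eX X
    g₁ = substL (++-assoc₃ σ as' ρ (⊗ as ∷ Γr)) LX
    H₂ = idsL ρ ++H (Tt ∷ idsL Γr)
    LL₁ = lift σ as' (ρ ++ ⊗ as ∷ Γr) refl g₁
    LX' = lift σ as' (ρ ++ as ++ Γr) eX' X
    g₂ = substL (sym (++-assoc σ (⊗ as' ∷ ρ) (as ++ Γr))) LX'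
    H₁ = idsL σ ++H (Tt' ∷ idsL ρ)
    LL₂ = lift (σ ++ ⊗ as' ∷ ρ) as Γr refl g₂
    pW1' : W1 ≋ (g₁ ∘ (idsL σ ++H (idsL as' ++H H₂)))
    pW1' = pW1 ⟫ ∘-cong≋ (≋-sym (substL-≋ _ LX))
             (≐→≋* (++H-cong≐ (≡→≐ (idsL-++ σ (as' ++ ρ))
                               ⟫≐ ++H-cong≐ (≐-refl {xs = idsL σ}) (≡→≐ (idsL-++ as' ρ)))
                              (≐-refl {xs = Tt ∷ idsL Γr})
                    ⟫≐ ++H-assoc≐ (idsL σ) (idsL as' ++H idsL ρ) (Tt ∷ idsL Γr)
                    ⟫≐ ++H-cong≐ (≐-refl {xs = idsL σ})
                         (++H-assoc≐ (idsL as') (idsL ρ) (Tt ∷ idsL Γr))))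
    pW2' : W2 ≋ (g₂ ∘ (H₁ ++H (idsL as ++H idsL Γr)))
    pW2' = pW2 ⟫ ∘-cong≋ (≋-sym (substL-≋ _ LX'))
             (≐→≋* (++H-cong≐ (≐-refl {xs = idsL σ})
                      (∷-cong≐ Tt' (≡→≐ (idsL-++ ρ (as ++ Γr))
                                   ⟫≐ ++H-cong≐ (≐-refl {xs = idsL ρ}) (≡→≐ (idsL-++ as Γr))))
                    ⟫≐ ++H-cong≐ (≐-refl {xs = idsL σ})
                         (≐-sym (∷-++H≐ Tt' (idsL ρ) (idsL as ++H idsL Γr)))
                    ⟫≐ ≐-sym (++H-assoc≐ (idsL σ) (Tt' ∷ idsL ρ) (idsL as ++H idsL Γr))))
    LL₁≋LL₂ : LL₁ ≋ LL₂
    LL₁≋LL₂ =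
      lift-cong≋ σ as' (ρ ++ ⊗ as ∷ Γr) refl (++-assoc₃ σ as' ρ (⊗ as ∷ Γr)) (substL-≋ _ LX)
      ⟫ ≋-sym (lift-lift σ as' ρ as Γr X eX' (sym (++-assoc σ (⊗ as' ∷ ρ) (as ++ Γr))) eX
                 (++-assoc₃ σ as' ρ (⊗ as ∷ Γr)))
      ⟫ lift-cong≋ (σ ++ ⊗ as' ∷ ρ) as Γr (sym (++-assoc σ (⊗ as' ∷ ρ) (as ++ Γr))) refl
           (≋-sym (substL-≋ _ LX'))
    Ts = H₁ ++H (Tt ∷ idsL Γr)
    f₁≋LL₂∘Ts : f₁ ≋ (LL₂ ∘ Ts)
    f₁≋LL₂∘Ts =
      p₁
      ⟫ ∘-cong≋ (lift-∘-outer e₁ g₁ (idsL σ) H₂ W1 pW1') (≐→≋* (++H-cong≐ (≐-refl {xs = idsL σ})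
                   (≐-sym (∷-++H≐ Tt' [] (idsL (ρ ++ γ ++ Γr))))))
      ⟫ ≈→≋ (∘-interchange LL₁ (idsL σ) (id (⊗ as')) H₂ (idsL σ) (Tt' ∷ []) (idsL (ρ ++ γ ++ Γr)))
      ⟫ ∘-cong≋ LL₁≋LL₂ (++H-cong≋* (≈*→≋* (∘*-idsL (idsL σ)))
                           (∷-cong≋* (id-∘-∷[] Tt') (≈*→≋* (∘*-idsL H₂)))
                         ⟫* ≐→≋* (++H-cong≐ (≐-refl {xs = idsL σ})
                                    (≐-sym (∷-++H≐ Tt' (idsL ρ) (Tt ∷ idsL Γr)))
                                  ⟫≐ ≐-sym (++H-assoc≐ (idsL σ) (Tt' ∷ idsL ρ) (Tt ∷ idsL Γr))))
    f₂≋LL₂∘Ts : f₂ ≋ (LL₂ ∘ Ts)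
    f₂≋LL₂∘Ts =
      p₂
      ⟫ ∘-cong≋ (lift-∘-outer e₂ g₂ H₁ (idsL Γr) W2 pW2')
           (≐→≋* (++H-cong≐ (≐-refl {xs = idsL (σ ++ γ' ++ ρ)})
                    (≐-sym (∷-++H≐ Tt [] (idsL Γr)))))
      ⟫ ≈→≋ (∘-interchange LL₂ H₁ (id (⊗ as)) (idsL Γr) (idsL (σ ++ γ' ++ ρ)) (Tt ∷ []) (idsL Γr))
      ⟫ ∘-cong≋ʳ LL₂ (++H-cong≋* (≈*→≋* (∘*-idsL H₁))
                        (∷-cong≋* (id-∘-∷[] Tt) (≈*→≋* (∘*-idsL (idsL Γr)))))


module SubstitutionProperties (A : Set) (R : Signature A) where
  open Free A R
  module TL = HomListProperties Term

  vars-++ : ∀ x y → vars (x ++ y) ≡ vars x ++H vars y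
  vars-++ [] y = refl
  vars-++ (a ∷ x) y = trans (cong (var ∷_) (vars-++ x y))
                            (TL.≐→≡ (TL.≐-sym (TL.∷-++H≐ var (vars x) (vars y))))

  vars-++₃ : ∀ δ as δ' → vars (δ ++ as ++ δ') ≡ vars δ ++H (vars as ++H vars δ')
  vars-++₃ δ as δ' = trans (vars-++ δ (as ++ δ')) (cong (vars δ ++H_) (vars-++ as δ'))

  sub-vars : ∀ {Γ b} (s : Term Γ b) → sub s (vars Γ) ≡ s
  sub*-vars : ∀ {Γ bs} (ss : Terms Γ bs) → sub* ss (vars Γ) ≡ ss
  sub-vars var = refl
  sub-vars (app f ss) = cong (app f) (sub*-vars ss)
  sub-vars (tup ss) = cong tup (sub*-vars ss)
  sub-vars (letT {as} {γ} δ δ' s t)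
    rewrite vars-++ δ (γ ++ δ') | vars-++ γ δ'
          | TL.split-++H (vars δ) (vars γ ++H vars δ') | TL.split-++H (vars γ) (vars δ') =
    cong₂ (letT δ δ')
      (trans (cong (sub s) (sym (vars-++₃ δ as δ'))) (sub-vars s))
      (sub-vars t)
  sub*-vars [] = refl
  sub*-vars (_∷_ {Δ₁} {Δ₂} s ss)
    rewrite vars-++ Δ₁ Δ₂ | TL.split-++H (vars Δ₁) (vars Δ₂) =
    cong₂ _∷_ (sub-vars s) (sub*-vars ss)

  castL-∷-castT : ∀ {Γt Y Δ a as} (p : Γt ≡ Y) (E : Y ++ Δ ≡ Γt ++ Δ) (t : Term Γt a) (ts : Terms Δ as) →
           castL E (castT p t ∷ ts) ≡ t ∷ ts
  castL-∷-castT refl E t ts = cong (λ e → castL e (t ∷ ts)) (uip E refl)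

  vars-sub* : ∀ {Γ as} (ss : Terms Γ as) → sub* (vars as) ss ≡ ss
  vars-sub* [] = refl
  vars-sub* (_∷_ {Γt} {Δ} t ts) =
    trans (cong (λ z → castL _ (castT (sym (++-identityʳ Γt)) t ∷ z)) (vars-sub* ts))
          (castL-∷-castT (sym (++-identityʳ Γt)) _ t ts)

  castT-letT-castT : ∀ δ δ' {as γ Y b} (p : γ ≡ Y) (E : δ ++ Y ++ δ' ≡ δ ++ γ ++ δ')
            (s : Term (δ ++ as ++ δ') b) (t : Term γ (tensor as)) →
            castT E (letT δ δ' s (castT p t)) ≡ letT δ δ' s t
  castT-letT-castT δ δ' refl E s t = cong (λ e → castT e (letT δ δ' s t)) (uip E refl)

  sub-vars₃ : ∀ δ as δ' {b} (s : Term (δ ++ as ++ δ') b) →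
          sub s (vars δ ++H (vars as ++H vars δ')) ≡ s
  sub-vars₃ δ as δ' s =
    trans (cong (sub s) (sym (vars-++₃ δ as δ'))) (sub-vars s)

  letVar-sub : ∀ δ δ' {as γ b} (s : Term (δ ++ as ++ δ') b) (t : Term γ (tensor as)) →
           sub (letT δ δ' s (var {tensor as})) (vars δ ++H (t ∷ vars δ')) ≡ letT δ δ' s t
  letVar-sub δ δ' {as} {γ} s t rewrite TL.split-++H (vars δ) (t ∷ vars δ') =
    trans (cong (λ z → castT _ (letT δ δ' z (castT (sym (++-identityʳ γ)) t))) (sub-vars₃ δ as δ' s))
          (castT-letT-castT δ δ' (sym (++-identityʳ γ)) _ s t)


module Interpretation (A : Set) (R : Signature A) {o h e} (S : MultiData o h e)
         (isRep : IsRepMulticategory S) (i : SigMap A R S) where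
  open MultiData S
  open MOps S
  open HomListProperties Hom
  open CompositionProperties S
  open IsRepMulticategory isRep
  open MulticategoryProperties S isRep
  open LiftProperties S isRep
  open SigMap i
  private
    module T = Free A R
    module TL = HomListProperties T.Term
  open T using (Term; Terms; var; app; tup; letT; castT; vars; sub; sub*)

  i₀* : List (Ty A) → List Obj
  i₀* = map i₀

  map-++₃ : ∀ δ as δ' → i₀* (δ ++ as ++ δ') ≡ i₀* δ ++ i₀* as ++ i₀* δ'
  map-++₃ δ as δ' = trans (map-++ i₀ δ (as ++ δ')) (cong (i₀* δ ++_) (map-++ i₀ as δ'))

  map-++₅ˡ : ∀ x y z u v → i₀* ((x ++ y ++ z) ++ u ++ v) ≡ (i₀* x ++ i₀* y ++ i₀* z) ++ i₀* u ++ i₀* v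
  map-++₅ˡ x y z u v = trans (map-++₃ (x ++ y ++ z) u v) (cong (_++ (i₀* u ++ i₀* v)) (map-++₃ x y z))

  map-++₅ʳ : ∀ x y z u v → i₀* (x ++ y ++ (z ++ u ++ v)) ≡ i₀* x ++ i₀* y ++ (i₀* z ++ i₀* u ++ i₀* v)
  map-++₅ʳ x y z u v = trans (map-++₃ x y (z ++ u ++ v)) (cong (λ W → i₀* x ++ i₀* y ++ W) (map-++₃ z u v))

  map-++₄ : ∀ x y as z w → i₀* ((x ++ y) ++ as ++ (z ++ w)) ≡ (i₀* x ++ i₀* y) ++ i₀* as ++ (i₀* z ++ i₀* w)
  map-++₄ x y as z w = trans (map-++₃ (x ++ y) as (z ++ w))
                        (cong₂ (λ P Q → P ++ i₀* as ++ Q) (map-++ i₀ x y) (map-++ i₀ z w))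

  toTensor : ∀ {Γ} as → Hom Γ (i₀ (tensor as)) → Hom Γ (⊗ (i₀* as))
  toTensor {Γ} as f = subst (Hom Γ) (i₀-⊗ as) f

  liftᵢ : ∀ δ as δ' {b} → Hom (i₀* (δ ++ as ++ δ')) (i₀ b) → Hom (i₀* δ ++ ⊗ (i₀* as) ∷ i₀* δ') (i₀ b)
  liftᵢ δ as δ' f = lift (i₀* δ) (i₀* as) (i₀* δ') (map-++₃ δ as δ') f

  interpLet : ∀ δ δ' {as γ b} → Hom (i₀* (δ ++ as ++ δ')) (i₀ b) → Hom (i₀* γ) (i₀ (tensor as)) →
         Hom (i₀* (δ ++ γ ++ δ')) (i₀ b)
  interpLet δ δ' {as} {γ} f t =
    substL (sym (map-++₃ δ γ δ'))
      (liftᵢ δ as δ' f ∘ (idsL (i₀* δ) ++H (toTensor as t ∷ idsL (i₀* δ'))))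

  ⟦_⟧ : ∀ {Γ a} → Term Γ a → Hom (i₀* Γ) (i₀ a)
  ⟦_⟧* : ∀ {Γ as} → Terms Γ as → HomList (i₀* Γ) (i₀* as)
  ⟦ var {a} ⟧ = id (i₀ a)
  ⟦ app f ss ⟧ = i₁ f ∘ ⟦ ss ⟧*
  ⟦ tup {Γ} {as} ss ⟧ = subst (Hom (i₀* Γ)) (sym (i₀-⊗ as)) (re (i₀* as) ∘ ⟦ ss ⟧*)
  ⟦ letT δ δ' s t ⟧ = interpLet δ δ' ⟦ s ⟧ ⟦ t ⟧
  ⟦ T.[] ⟧* = []
  ⟦ T._∷_ {Γ} {Δ} s ss ⟧* = castL (sym (map-++ i₀ Γ Δ)) (⟦ s ⟧ ∷ ⟦ ss ⟧*)

  ⟦∷⟧ : ∀ {Γ Δ a as} (s : Term Γ a) (ss : Terms Δ as) → ⟦ s T.∷ ss ⟧* ≐ (⟦ s ⟧ ∷ ⟦ ss ⟧*)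
  ⟦∷⟧ s ss = castL-≐ _ _

  ⟦castT⟧ : ∀ {Γ Γ' a} (p : Γ ≡ Γ') (s : Term Γ a) → ⟦ castT p s ⟧ ≋ ⟦ s ⟧
  ⟦castT⟧ refl s = ≋-refl

  -- ⟦_⟧* is mapHL ⟦_⟧ unfolded, so that its mutual recursion with ⟦_⟧ is structural.
  ⟦⟧*-mapHL : ∀ {Γ as} (ss : Terms Γ as) → ⟦ ss ⟧* ≡ mapHL (FR A R) S i₀ ⟦_⟧ ss
  ⟦⟧*-mapHL T.[] = refl
  ⟦⟧*-mapHL (T._∷_ {Γ} {Δ} s ss) =
    cong (λ z → castL (sym (map-++ i₀ Γ Δ)) (⟦ s ⟧ ∷ z)) (⟦⟧*-mapHL ss)

  ⟦++⟧ : ∀ {Γ₁ Γ₂ as bs} (xs : Terms Γ₁ as) (ys : Terms Γ₂ bs) →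
         ⟦ xs T.++H ys ⟧* ≐ (⟦ xs ⟧* ++H ⟦ ys ⟧*)
  ⟦++⟧ xs ys =
    ≡→≐ (⟦⟧*-mapHL (xs T.++H ys))
    ⟫≐ MapHLProperties.mapHL-++H (FR A R) S i₀ ⟦_⟧ xs ys
    ⟫≐ ≐-sym (++H-cong≐ (≡→≐ (⟦⟧*-mapHL xs)) (≡→≐ (⟦⟧*-mapHL ys)))

  ⟦vars⟧ : ∀ as → ⟦ vars as ⟧* ≐ idsL (i₀* as)
  ⟦vars⟧ [] = ≐-refl
  ⟦vars⟧ (a ∷ as) = ⟦∷⟧ var (vars as) ⟫≐ ∷-cong≐ (id (i₀ a)) (⟦vars⟧ as)

  toTensor-≋ : ∀ {Γ} as (f : Hom Γ (i₀ (tensor as))) → toTensor as f ≋ f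
  toTensor-≋ as f = subst-≋ (i₀-⊗ as) f

  ⟦let⟧ : ∀ δ δ' {as γ b} (s : Term (δ ++ as ++ δ') b) (t : Term γ (tensor as)) →
          ⟦ letT δ δ' s t ⟧ ≋ (liftᵢ δ as δ' ⟦ s ⟧ ∘ (idsL (i₀* δ) ++H (toTensor as ⟦ t ⟧ ∷ idsL (i₀* δ'))))
  ⟦let⟧ δ δ' s t = substL-≋ _ _

  ⟦tup⟧ : ∀ {Γ as} (ss : Terms Γ as) → ⟦ tup ss ⟧ ≋ (re (i₀* as) ∘ ⟦ ss ⟧*)
  ⟦tup⟧ {as = as} ss = subst-≋ (sym (i₀-⊗ as)) _

  ⟦sub⟧ : ∀ {Γ Δ b} (s : Term Δ b) (us : Terms Γ Δ) → ⟦ sub s us ⟧ ≋ (⟦ s ⟧ ∘ ⟦ us ⟧*)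
  ⟦sub*⟧ : ∀ {Γ Δ bs} (ss : Terms Δ bs) (us : Terms Γ Δ) → ⟦ sub* ss us ⟧* ≋* (⟦ ss ⟧* ∘* ⟦ us ⟧*)

  ⟦sub⟧ var (T._∷_ {Γa} t T.[]) =
    ⟦castT⟧ (sym (++-identityʳ Γa)) t
    ⟫ ≋-sym (∘-cong≋ʳ (id _) (≐→≋* (⟦∷⟧ t T.[])) ⟫ id-∘-∷[] ⟦ t ⟧)
  ⟦sub⟧ (app f ss) us =
    ∘-cong≋ʳ (i₁ f) (⟦sub*⟧ ss us) ⟫ ≈→≋ (≈-sym (assoc (i₁ f) ⟦ ss ⟧* ⟦ us ⟧*))
  ⟦sub⟧ (tup {as = as} ss) us =
    ⟦tup⟧ (sub* ss us)
    ⟫ ∘-cong≋ʳ (re (i₀* as)) (⟦sub*⟧ ss us)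
    ⟫ ≈→≋ (≈-sym (assoc (re (i₀* as)) ⟦ ss ⟧* ⟦ us ⟧*))
    ⟫ ∘-cong≋ (≋-sym (⟦tup⟧ ss)) ≋*-refl
  -- Both sides are the lift of ⟦s⟧ precomposed with ⟦u⃗₁⟧, ⟦t⟧ ∘ ⟦u⃗₂⟧ and ⟦u⃗₃⟧.
  ⟦sub⟧ (letT {as} {γ} δ δ' s t) us with TL.splitView δ (γ ++ δ') us
  ... | TL.sv {Γ₁} refl us₁ usr with TL.splitView γ δ' usr
  ... | TL.sv {Γ₂} {Γ₃} refl us₂ us₃
    rewrite TL.split-++H us₁ (us₂ T.++H us₃) | TL.split-++H us₂ us₃ =
    ⟦let⟧ Γ₁ Γ₃ S' T'
    ⟫ ∘-cong≋ (lift-∘-outer (map-++₃ Γ₁ as Γ₃) g U₁ U₃ ⟦ S' ⟧ pf)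
              (≐→≋* (++H-cong≐ (≐-refl {xs = idsL (i₀* Γ₁)})
                       (≐-sym (∷-++H≐ (toTensor as ⟦ T' ⟧) [] (idsL (i₀* Γ₃))))))
    ⟫ ≈→≋ (∘-interchange Lg U₁ (id (⊗ (i₀* as))) U₃ (idsL (i₀* Γ₁)) (toTensor as ⟦ T' ⟧ ∷ [])
                (idsL (i₀* Γ₃)))
    ⟫ ∘-cong≋ʳ Lg (++H-cong≋* (≈*→≋* (∘*-idsL U₁))
               (∷-cong≋* (id-∘-∷[] (toTensor as ⟦ T' ⟧) ⟫ toTensor-≋ as ⟦ T' ⟧ ⟫ ⟦sub⟧ t us₂
                            ⟫ ∘-cong≋ (≋-sym (toTensor-≋ as ⟦ t ⟧)) ≋*-refl)
                         (≈*→≋* (∘*-idsL U₃))))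
    ⟫ ≋-sym
      (∘-cong≋ (⟦let⟧ δ δ' s t)
               (≐→≋* (⟦++⟧ us₁ (us₂ T.++H us₃)
                        ⟫≐ ++H-cong≐ (≐-refl {xs = U₁}) (⟦++⟧ us₂ us₃)))
       ⟫ ≈→≋ (∘-interchange Ls (idsL (i₀* δ)) (toTensor as ⟦ t ⟧) (idsL (i₀* δ')) U₁ U₂ U₃)
       ⟫ ∘-cong≋ (≈→≋ (lift-cong (i₀* δ) (i₀* as) (i₀* δ') (map-++₃ δ as δ') refl
                     (≋-sym (substL-≋ (map-++₃ δ as δ') ⟦ s ⟧))))
             (++H-cong≋* (idsL-∘* U₁) (∷-cong≋* ≋-refl (idsL-∘* U₃))))
    where
    S' = sub s (us₁ T.++H (vars as T.++H us₃))
    T' = sub t us₂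
    U₁ = ⟦ us₁ ⟧*
    U₂ = ⟦ us₂ ⟧*
    U₃ = ⟦ us₃ ⟧*
    g = substL (map-++₃ δ as δ') ⟦ s ⟧
    Lg = lift (i₀* δ) (i₀* as) (i₀* δ') refl g
    Ls = liftᵢ δ as δ' ⟦ s ⟧
    pf : ⟦ S' ⟧ ≋ (g ∘ (U₁ ++H (idsL (i₀* as) ++H U₃)))
    pf = ⟦sub⟧ s (us₁ T.++H (vars as T.++H us₃))
         ⟫ ∘-cong≋ (≋-sym (substL-≋ (map-++₃ δ as δ') ⟦ s ⟧))
             (≐→≋* (⟦++⟧ us₁ (vars as T.++H us₃)
                    ⟫≐ ++H-cong≐ (≐-refl {xs = U₁})
                         (⟦++⟧ (vars as) us₃ ⟫≐ ++H-cong≐ (⟦vars⟧ as) (≐-refl {xs = U₃}))))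

  ⟦sub*⟧ T.[] T.[] = ≋*-refl
  ⟦sub*⟧ (T._∷_ {Δ₁} {Δ₂} s ss) us with TL.splitView Δ₁ Δ₂ us
  ... | TL.sv refl us₁ us₂ rewrite TL.split-++H us₁ us₂ =
    ≐→≋* (⟦∷⟧ (sub s us₁) (sub* ss us₂))
    ⟫* ∷-cong≋* (⟦sub⟧ s us₁) (⟦sub*⟧ ss us₂)
    ⟫* ≋*-sym (≐→≋* (∘*-cong≐ (⟦∷⟧ s ss) (⟦++⟧ us₁ us₂)
                     ⟫≐ ≡→≐ (∷-∘*-++H ⟦ s ⟧ ⟦ ss ⟧* ⟦ us₁ ⟧* ⟦ us₂ ⟧*)))


module Soundness (A : Set) (R : Signature A) {o h e} (S : MultiData o h e)
         (isRep : IsRepMulticategory S) (i : SigMap A R S) where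
  open MultiData S
  open MOps S
  open HomListProperties Hom
  open IsRepMulticategory isRep
  open MulticategoryProperties S isRep
  open LiftProperties S isRep
  open SigMap i
  open Interpretation A R S isRep i
  private module T = Free A R
  open T using (Term; Terms; app; tup; letT; castT; vars; sub;
                Ctx; hole; tupC; appC; letBodyC; letBoundC; plug; castC;
                PCtx; phole; ptup; papp; pletBodyL; pletBodyR; pletBound; inst;
                LCtx; lhole; llet; plugL; plugLF; etaExp)

  ⟦mid⟧ : ∀ {S₁ S₂ Γ as₁ as₂ b} (ss₁ : Terms S₁ as₁) (x : Term Γ b) (ss₂ : Terms S₂ as₂) →
          ⟦ ss₁ T.++H (x T.∷ ss₂) ⟧* ≐ (⟦ ss₁ ⟧* ++H (⟦ x ⟧ ∷ ⟦ ss₂ ⟧*))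
  ⟦mid⟧ ss₁ x ss₂ = ⟦++⟧ ss₁ (x T.∷ ss₂)
                      ⟫≐ ++H-cong≐ (≐-refl {xs = ⟦ ss₁ ⟧*}) (⟦∷⟧ x ss₂)

  ⟦castC⟧ : ∀ {Θ a Γ Γ' b} (e : Γ ≡ Γ') (C : Ctx Θ a Γ b) (u : Term Θ a) →
               ⟦ plug (castC e C) u ⟧ ≋ ⟦ plug C u ⟧
  ⟦castC⟧ refl C u = ≋-refl

  ⟦plug⟧-cong : ∀ {Θ a Γ b} (C : Ctx Θ a Γ b) {u u' : Term Θ a} →
              ⟦ u ⟧ ≋ ⟦ u' ⟧ → ⟦ plug C u ⟧ ≋ ⟦ plug C u' ⟧
  ⟦plug⟧-cong hole p = p
  ⟦plug⟧-cong (tupC {as₁ = as₁} {as₂} {b} ss₁ C ss₂) {u} {u'} p =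
    ⟦tup⟧ (ss₁ T.++H (plug C u T.∷ ss₂)) ⟫ ∘-cong≋ʳ (re (i₀* (as₁ ++ b ∷ as₂)))
      (≐→≋* (⟦mid⟧ ss₁ (plug C u) ss₂)
       ⟫* ++H-cong≋* (≋*-refl {xs = ⟦ ss₁ ⟧*}) (∷-cong≋* (⟦plug⟧-cong C p) ≋*-refl)
       ⟫* ≋*-sym (≐→≋* (⟦mid⟧ ss₁ (plug C u') ss₂)))
    ⟫ ≋-sym (⟦tup⟧ (ss₁ T.++H (plug C u' T.∷ ss₂)))
  ⟦plug⟧-cong (appC f ss₁ C ss₂) {u} {u'} p =
    ∘-cong≋ʳ (i₁ f)
      (≐→≋* (⟦mid⟧ ss₁ (plug C u) ss₂)
       ⟫* ++H-cong≋* (≋*-refl {xs = ⟦ ss₁ ⟧*}) (∷-cong≋* (⟦plug⟧-cong C p) ≋*-refl)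
       ⟫* ≋*-sym (≐→≋* (⟦mid⟧ ss₁ (plug C u') ss₂)))
  ⟦plug⟧-cong (letBodyC {as} δ δ' C t) {u} {u'} p =
    ⟦let⟧ δ δ' (plug C u) t
    ⟫ ∘-cong≋ (lift-cong≋ (i₀* δ) (i₀* as) (i₀* δ') (map-++₃ δ as δ') (map-++₃ δ as δ')
                (⟦plug⟧-cong C p))
              ≋*-refl
    ⟫ ≋-sym (⟦let⟧ δ δ' (plug C u') t)
  ⟦plug⟧-cong (letBoundC {as} δ δ' s C) {u} {u'} p =
    ⟦let⟧ δ δ' s (plug C u)
    ⟫ ∘-cong≋ʳ (liftᵢ δ as δ' ⟦ s ⟧) (++H-cong≋* (≋*-refl {xs = idsL (i₀* δ)})
        (∷-cong≋* (toTensor-≋ as _ ⟫ ⟦plug⟧-cong C p ⟫ ≋-sym (toTensor-≋ as _)) ≋*-refl))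
    ⟫ ≋-sym (⟦let⟧ δ δ' s (plug C u'))

  -- The lift of re along the whole tensor is the identity.
  ⟦etaExp⟧ : ∀ {Γ as} (s : Term Γ (tensor as)) → ⟦ s ⟧ ≋ ⟦ etaExp s ⟧
  ⟦etaExp⟧ {Γ} {as} s =
    ≋-sym (⟦castT⟧ (++-identityʳ Γ) (letT [] [] V s)
           ⟫ ⟦let⟧ [] [] V s
           ⟫ ∘-cong≋ LV≋id ≋*-refl
           ⟫ id-∘-∷[] (toTensor as ⟦ s ⟧)
           ⟫ toTensor-≋ as ⟦ s ⟧)
    where
    V = castT (sym (++-identityʳ as)) (tup (vars as))
    LV≋id : liftᵢ [] as [] ⟦ V ⟧ ≋ id (⊗ (i₀* as))
    LV≋id = lift-cong≋ [] (i₀* as) [] (map-++₃ [] as []) (map-++₃ [] as []) (≋-sym (toTensor-≋ as ⟦ V ⟧))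
            ⟫ lift-unique [] (i₀* as) [] (map-++₃ [] as []) (toTensor as ⟦ V ⟧) (id _) (re (i₀* as) ∷ []) ≐-refl
              (id-∘-∷[] (re (i₀* as))
               ⟫ ≋-sym (toTensor-≋ as ⟦ V ⟧ ⟫ ⟦castT⟧ (sym (++-identityʳ as)) (tup (vars as)) ⟫ ⟦tup⟧ (vars as)
               ⟫ ∘-cong≋ʳ (re _) (≐→≋* (⟦vars⟧ as)) ⟫ ≈→≋ (id-right _)))

  ⟦let⟧-reindex : ∀ x y z w {as γ b} (Z : Term ((x ++ y) ++ as ++ (z ++ w)) b) (t : Term γ (tensor as))
         (e : i₀* ((x ++ y) ++ as ++ (z ++ w)) ≡ (i₀* x ++ i₀* y) ++ i₀* as ++ (i₀* z ++ i₀* w)) →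
         ⟦ letT (x ++ y) (z ++ w) Z t ⟧ ≋
         (lift (i₀* x ++ i₀* y) (i₀* as) (i₀* z ++ i₀* w) e ⟦ Z ⟧ ∘
           (idsL (i₀* x ++ i₀* y) ++H (toTensor as ⟦ t ⟧ ∷ idsL (i₀* z ++ i₀* w))))
  ⟦let⟧-reindex x y z w {as} Z t e =
    ⟦let⟧ (x ++ y) (z ++ w) Z t
    ⟫ ∘-cong≋ (lift-cong-reindex (map-++ i₀ x y) (map-++ i₀ z w) (map-++₃ (x ++ y) as (z ++ w)) e ≋-refl)
        (≐→≋* (++H-cong≐ (idsL-≐ (map-++ i₀ x y)) (∷-cong≐ (toTensor as ⟦ t ⟧) (idsL-≐ (map-++ i₀ z w)))))

  ⟦beta⟧ : ∀ {δ δ' as Θ γ b} (s : Term (δ ++ as ++ δ') b) (L : LCtx Θ γ) (ts : Terms Θ as) →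
         ⟦ letT δ δ' s (plugL L (tup ts)) ⟧ ≋
         ⟦ plugLF δ δ' L (sub s (vars δ T.++H (ts T.++H vars δ'))) ⟧
  ⟦beta⟧ {δ} {δ'} {as} s lhole ts =
    ⟦let⟧ δ δ' s (tup ts)
    ⟫ lift-∘-tuple (i₀* δ) (i₀* as) (i₀* δ') ⟦ s ⟧ (map-++₃ δ as δ') ⟦ ts ⟧* (toTensor as ⟦ tup ts ⟧) ⟦ W ⟧
        (toTensor-≋ as _ ⟫ ⟦tup⟧ ts) pf
    where
    W = sub s (vars δ T.++H (ts T.++H vars δ'))
    pf : ⟦ W ⟧ ≋ (substL (map-++₃ δ as δ') ⟦ s ⟧ ∘ (idsL (i₀* δ) ++H (⟦ ts ⟧* ++H idsL (i₀* δ'))))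
    pf = ⟦sub⟧ s (vars δ T.++H (ts T.++H vars δ'))
         ⟫ ∘-cong≋ (≋-sym (substL-≋ (map-++₃ δ as δ') ⟦ s ⟧))
             (≐→≋* (⟦++⟧ (vars δ) (ts T.++H vars δ')
                    ⟫≐ ++H-cong≐ (⟦vars⟧ δ)
                         (⟦++⟧ ts (vars δ') ⟫≐ ++H-cong≐ (≐-refl {xs = ⟦ ts ⟧*}) (⟦vars⟧ δ'))))
  -- The let binding the tuple floats out of the outer let, and β applies under it.
  ⟦beta⟧ {δ} {δ'} {as} s (llet {as'} {γ'} σ ρ L t) ts =
    float-inner-lift (liftᵢ δ as δ' ⟦ s ⟧) (idsL (i₀* δ)) (idsL (i₀* δ')) (map-++₃ σ as' ρ) (toTensor as ⟦ w ⟧)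
      (toTensor as' ⟦ t ⟧) (toTensor as ⟦ letT σ ρ w t ⟧) ⟦ letT δ δ' s (letT σ ρ w t) ⟧ ⟦ Z ⟧
      (map-++₄ δ σ as' ρ δ')
      (⟦let⟧ δ δ' s (letT σ ρ w t))
      (toTensor-≋ as _ ⟫ ⟦let⟧ σ ρ w t
       ⟫ ∘-cong≋ (lift-cong≋ (i₀* σ) (i₀* as') (i₀* ρ) (map-++₃ σ as' ρ) (map-++₃ σ as' ρ)
                    (≋-sym (toTensor-≋ as ⟦ w ⟧))) ≋*-refl)
      (⟦castT⟧ (reassoc δ σ as' ρ δ') (plugLF δ δ' L W) ⟫ ≋-sym (⟦beta⟧ s L ts) ⟫ ⟦let⟧ δ δ' s w)
    ⟫ ≋-sym (⟦castT⟧ (sym (reassoc δ σ γ' ρ δ')) (letT (δ ++ σ) (ρ ++ δ') Z t)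
             ⟫ ⟦let⟧-reindex δ σ ρ δ' Z t (map-++₄ δ σ as' ρ δ'))
    where
    w = plugL L (tup ts)
    W = sub s (vars δ T.++H (ts T.++H vars δ'))
    Z = castT (reassoc δ σ as' ρ δ') (plugLF δ δ' L W)

  Floats : ∀ {δ δ' b Γl Γr c as γ} → PCtx δ δ' b Γl Γr c →
           Term (δ ++ as ++ δ') b → Term γ (tensor as) → Set (o ⊔ e)
  Floats {δ} {δ'} {Γl = Γl} {Γr} {as = as} {γ} P s t =
    ⟦ plug (inst P γ) (letT δ δ' s t) ⟧ ≋ ⟦ letT Γl Γr (plug (inst P as) s) t ⟧

  ⟦float⟧-tup : ∀ {δ δ' b Γl Γr as γ S₁ S₂ as₁ as₂ b'}
    (ss₁ : Terms S₁ as₁) (P : PCtx δ δ' b Γl Γr b') (ss₂ : Terms S₂ as₂)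
    (s : Term (δ ++ as ++ δ') b) (t : Term γ (tensor as)) →
    Floats P s t → Floats (ptup ss₁ P ss₂) s t
  ⟦float⟧-tup {δ} {δ'} {b} {Γl} {Γr} {as} {γ} {S₁} {S₂} {as₁} {as₂} {b'} ss₁ P ss₂ s t ih =
    ⟦castC⟧ (reassoc S₁ Γl γ Γr S₂) (tupC ss₁ (inst P γ) ss₂) (letT δ δ' s t)
    ⟫ float-inner-lift g ⟦ ss₁ ⟧* ⟦ ss₂ ⟧* (map-++₃ Γl as Γr) ⟦ W ⟧ (toTensor as ⟦ t ⟧) ⟦ W₁ ⟧
        ⟦ tup (ss₁ T.++H (W₁ T.∷ ss₂)) ⟧ ⟦ Z ⟧ (map-++₄ S₁ Γl as Γr S₂)
        (⟦tup⟧ (ss₁ T.++H (W₁ T.∷ ss₂))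
         ⟫ ∘-cong≋ g≋ (≐→≋* (⟦mid⟧ ss₁ W₁ ss₂)))
        (ih ⟫ ⟦let⟧ Γl Γr W t)
        (⟦castC⟧ (reassoc S₁ Γl as Γr S₂) (tupC ss₁ (inst P as) ss₂) s
         ⟫ ⟦tup⟧ (ss₁ T.++H (W T.∷ ss₂))
         ⟫ ∘-cong≋ g≋ (≐→≋* (⟦mid⟧ ss₁ W ss₂)))
    ⟫ ≋-sym (⟦let⟧-reindex S₁ Γl Γr S₂ Z t (map-++₄ S₁ Γl as Γr S₂))
    where
    W₁ = plug (inst P γ) (letT δ δ' s t)
    W = plug (inst P as) s
    Z = plug (inst (ptup ss₁ P ss₂) as) s
    r0 = re (i₀* (as₁ ++ b' ∷ as₂))
    r1 = subst (Hom (i₀* (as₁ ++ b' ∷ as₂))) (sym (i₀-⊗ (as₁ ++ b' ∷ as₂))) r0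
    g = substL (map-++ i₀ as₁ (b' ∷ as₂)) r1
    g≋ : r0 ≋ g
    g≋ = ≋-sym (substL-≋ (map-++ i₀ as₁ (b' ∷ as₂)) r1 ⟫ subst-≋ (sym (i₀-⊗ (as₁ ++ b' ∷ as₂))) r0)

  ⟦float⟧-app : ∀ {δ δ' b Γl Γr as γ S₁ S₂ as₁ as₂ b' c}
    (f : R (as₁ ++ b' ∷ as₂) c) (ss₁ : Terms S₁ as₁) (P : PCtx δ δ' b Γl Γr b')
    (ss₂ : Terms S₂ as₂) (s : Term (δ ++ as ++ δ') b) (t : Term γ (tensor as)) →
    Floats P s t → Floats (papp f ss₁ P ss₂) s t
  ⟦float⟧-app {δ} {δ'} {b} {Γl} {Γr} {as} {γ} {S₁} {S₂} {as₁} {as₂} {b'} f ss₁ P ss₂ s t ih =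
    ⟦castC⟧ (reassoc S₁ Γl γ Γr S₂) (appC f ss₁ (inst P γ) ss₂) (letT δ δ' s t)
    ⟫ float-inner-lift g ⟦ ss₁ ⟧* ⟦ ss₂ ⟧* (map-++₃ Γl as Γr) ⟦ W ⟧ (toTensor as ⟦ t ⟧) ⟦ W₁ ⟧
        ⟦ app f (ss₁ T.++H (W₁ T.∷ ss₂)) ⟧ ⟦ Z ⟧ (map-++₄ S₁ Γl as Γr S₂)
        (∘-cong≋ (≋-sym (substL-≋ _ _)) (≐→≋* (⟦mid⟧ ss₁ W₁ ss₂)))
        (ih ⟫ ⟦let⟧ Γl Γr W t)
        (⟦castC⟧ (reassoc S₁ Γl as Γr S₂) (appC f ss₁ (inst P as) ss₂) s
         ⟫ ∘-cong≋ (≋-sym (substL-≋ _ _)) (≐→≋* (⟦mid⟧ ss₁ W ss₂)))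
    ⟫ ≋-sym (⟦let⟧-reindex S₁ Γl Γr S₂ Z t (map-++₄ S₁ Γl as Γr S₂))
    where
    W₁ = plug (inst P γ) (letT δ δ' s t)
    W = plug (inst P as) s
    Z = plug (inst (papp f ss₁ P ss₂) as) s
    g = substL (map-++ i₀ as₁ (b' ∷ as₂)) (i₁ f)

  ⟦float⟧-letBound : ∀ {δ δ' b Γl Γr as γ as' b'} (σ σ' : List (Ty A))
    (s' : Term (σ ++ as' ++ σ') b') (P : PCtx δ δ' b Γl Γr (tensor as'))
    (s : Term (δ ++ as ++ δ') b) (t : Term γ (tensor as)) →
    Floats P s t → Floats (pletBound σ σ' s' P) s t
  ⟦float⟧-letBound {δ} {δ'} {b} {Γl} {Γr} {as} {γ} {as'} {b'} σ σ' s' P s t ih =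
    ⟦castC⟧ (reassoc σ Γl γ Γr σ') (letBoundC σ σ' s' (inst P γ)) (letT δ δ' s t)
    ⟫ float-inner-lift (liftᵢ σ as' σ' ⟦ s' ⟧) (idsL (i₀* σ)) (idsL (i₀* σ')) (map-++₃ Γl as Γr)
        (toTensor as' ⟦ W ⟧) (toTensor as ⟦ t ⟧) (toTensor as' ⟦ W₁ ⟧)
        ⟦ letT σ σ' s' W₁ ⟧ ⟦ Z ⟧ (map-++₄ σ Γl as Γr σ')
        (⟦let⟧ σ σ' s' W₁)
        (toTensor-≋ as' ⟦ W₁ ⟧ ⟫ ih ⟫ ⟦let⟧ Γl Γr W t
         ⟫ ∘-cong≋ (lift-cong≋ (i₀* Γl) (i₀* as) (i₀* Γr) (map-++₃ Γl as Γr) (map-++₃ Γl as Γr)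
                      (≋-sym (toTensor-≋ as' ⟦ W ⟧))) ≋*-refl)
        (⟦castC⟧ (reassoc σ Γl as Γr σ') (letBoundC σ σ' s' (inst P as)) s
         ⟫ ⟦let⟧ σ σ' s' W)
    ⟫ ≋-sym (⟦let⟧-reindex σ Γl Γr σ' Z t (map-++₄ σ Γl as Γr σ'))
    where
    W₁ = plug (inst P γ) (letT δ δ' s t)
    W = plug (inst P as) s
    Z = plug (inst (pletBound σ σ' s' P) as) s

  ⟦float⟧-letBodyL : ∀ {δ δ' b Γr as γ as' γ' c'} (σ ρ : List (Ty A))
    (P : PCtx δ δ' b (σ ++ as' ++ ρ) Γr c') (t' : Term γ' (tensor as'))
    (s : Term (δ ++ as ++ δ') b) (t : Term γ (tensor as)) →
    Floats P s t → Floats (pletBodyL σ ρ P t') s t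
  ⟦float⟧-letBodyL {δ} {δ'} {b} {Γr} {as} {γ} {as'} {γ'} {c'} σ ρ P t' s t ih =
    lift-∘-lift-∘-comm (i₀* σ) (i₀* as') (i₀* ρ) (i₀* as) (i₀* Γr) (i₀* γ) (i₀* γ') ⟦ W ⟧ eX eX'
        (toTensor as ⟦ t ⟧) (toTensor as' ⟦ t' ⟧) ⟦ Y₁ ⟧ (map-++₅ʳ σ as' ρ γ Γr) ⟦ Z ⟧ (map-++₅ˡ σ γ' ρ as Γr)
        ⟦ plug (inst (pletBodyL σ ρ P t') γ) (letT δ δ' s t) ⟧ ⟦ letT (σ ++ γ' ++ ρ) Γr Z t ⟧
        p₁ pW1 p₂ pW2
    where
    W = plug (inst P as) s
    Y₁ = plug (castC (reassoc [] σ as' ρ (γ ++ Γr)) (inst P γ)) (letT δ δ' s t)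
    Y = plug (castC (reassoc [] σ as' ρ (as ++ Γr)) (inst P as)) s
    Z = plug (inst (pletBodyL σ ρ P t') as) s
    eX = map-++₅ˡ σ as' ρ as Γr
    eX' = trans (map-++₅ˡ σ as' ρ as Γr) (++-assoc₃ (i₀* σ) (i₀* as') (i₀* ρ) (i₀* as ++ i₀* Γr))
    p₁ = ⟦castC⟧ (sym (reassoc [] σ γ' ρ (γ ++ Γr)))
           (letBodyC σ (ρ ++ γ ++ Γr) (castC (reassoc [] σ as' ρ (γ ++ Γr)) (inst P γ)) t')
           (letT δ δ' s t)
         ⟫ ⟦let⟧ σ (ρ ++ γ ++ Γr) Y₁ t'
         ⟫ ∘-cong≋ (lift-cong-reindex refl (map-++₃ ρ γ Γr)
                       (map-++₃ σ as' (ρ ++ γ ++ Γr)) (map-++₅ʳ σ as' ρ γ Γr) ≋-refl)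
             (≐→≋* (++H-cong≐ (≐-refl {xs = idsL (i₀* σ)})
                      (∷-cong≐ (toTensor as' ⟦ t' ⟧) (idsL-≐ (map-++₃ ρ γ Γr)))))
    pW1 = ⟦castC⟧ (reassoc [] σ as' ρ (γ ++ Γr)) (inst P γ) (letT δ δ' s t)
          ⟫ ih ⟫ ⟦let⟧ (σ ++ as' ++ ρ) Γr W t
          ⟫ ∘-cong≋ (lift-cong-reindex (map-++₃ σ as' ρ) refl (map-++₃ (σ ++ as' ++ ρ) as Γr) eX ≋-refl)
              (≐→≋* (++H-cong≐ (idsL-≐ (map-++₃ σ as' ρ)) (≐-refl {xs = toTensor as ⟦ t ⟧ ∷ idsL (i₀* Γr)})))
    p₂ = ⟦let⟧ (σ ++ γ' ++ ρ) Γr Z t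
         ⟫ ∘-cong≋ (lift-cong-reindex (map-++₃ σ γ' ρ) refl
                       (map-++₃ (σ ++ γ' ++ ρ) as Γr) (map-++₅ˡ σ γ' ρ as Γr) ≋-refl)
             (≐→≋* (++H-cong≐ (idsL-≐ (map-++₃ σ γ' ρ)) (≐-refl {xs = toTensor as ⟦ t ⟧ ∷ idsL (i₀* Γr)})))
    pW2 = ⟦castC⟧ (sym (reassoc [] σ γ' ρ (as ++ Γr)))
            (letBodyC σ (ρ ++ as ++ Γr) (castC (reassoc [] σ as' ρ (as ++ Γr)) (inst P as)) t') s
          ⟫ ⟦let⟧ σ (ρ ++ as ++ Γr) Y t'
          ⟫ ∘-cong≋ (lift-cong-reindex refl (map-++₃ ρ as Γr) (map-++₃ σ as' (ρ ++ as ++ Γr)) eX'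
                       (⟦castC⟧ (reassoc [] σ as' ρ (as ++ Γr)) (inst P as) s))
              (≐→≋* (++H-cong≐ (≐-refl {xs = idsL (i₀* σ)})
                       (∷-cong≐ (toTensor as' ⟦ t' ⟧) (idsL-≐ (map-++₃ ρ as Γr)))))

  ⟦float⟧-letBodyR : ∀ {δ δ' b Γl as γ as' γ' c'} (σ ρ : List (Ty A))
    (P : PCtx δ δ' b Γl (σ ++ as' ++ ρ) c') (t' : Term γ' (tensor as'))
    (s : Term (δ ++ as ++ δ') b) (t : Term γ (tensor as)) →
    Floats P s t → Floats (pletBodyR σ ρ P t') s t
  ⟦float⟧-letBodyR {δ} {δ'} {b} {Γl} {as} {γ} {as'} {γ'} {c'} σ ρ P t' s t ih =
    ≋-sym (lift-∘-lift-∘-comm (i₀* Γl) (i₀* as) (i₀* σ) (i₀* as') (i₀* ρ) (i₀* γ') (i₀* γ) ⟦ W ⟧ eX eX'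
        (toTensor as' ⟦ t' ⟧) (toTensor as ⟦ t ⟧) ⟦ Z ⟧ (map-++₅ʳ Γl as σ γ' ρ) ⟦ Y₁ ⟧ (map-++₅ˡ Γl γ σ as' ρ)
        ⟦ letT Γl (σ ++ γ' ++ ρ) Z t ⟧ ⟦ plug (inst (pletBodyR σ ρ P t') γ) (letT δ δ' s t) ⟧
        p₁ pW1 p₂ pW2)
    where
    W = plug (inst P as) s
    Y₁ = plug (castC (reassoc₂ Γl γ σ (as' ++ ρ)) (inst P γ)) (letT δ δ' s t)
    Y = plug (castC (reassoc₂ Γl as σ (as' ++ ρ)) (inst P as)) s
    Z = plug (inst (pletBodyR σ ρ P t') as) s
    eX = trans (cong i₀* (reassoc₂ Γl as σ (as' ++ ρ))) (map-++₅ˡ Γl as σ as' ρ)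
    eX' = map-++₅ʳ Γl as σ as' ρ
    p₁ = ⟦let⟧ Γl (σ ++ γ' ++ ρ) Z t
         ⟫ ∘-cong≋ (lift-cong-reindex refl (map-++₃ σ γ' ρ)
                       (map-++₃ Γl as (σ ++ γ' ++ ρ)) (map-++₅ʳ Γl as σ γ' ρ) ≋-refl)
             (≐→≋* (++H-cong≐ (≐-refl {xs = idsL (i₀* Γl)})
                      (∷-cong≐ (toTensor as ⟦ t ⟧) (idsL-≐ (map-++₃ σ γ' ρ)))))
    pW1 = ⟦castC⟧ (sym (reassoc₂ Γl as σ (γ' ++ ρ)))
            (letBodyC (Γl ++ as ++ σ) ρ (castC (reassoc₂ Γl as σ (as' ++ ρ)) (inst P as)) t') s
          ⟫ ⟦let⟧ (Γl ++ as ++ σ) ρ Y t'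
          ⟫ ∘-cong≋ (lift-cong-reindex (map-++₃ Γl as σ) refl (map-++₃ (Γl ++ as ++ σ) as' ρ) eX
                       (⟦castC⟧ (reassoc₂ Γl as σ (as' ++ ρ)) (inst P as) s))
              (≐→≋* (++H-cong≐ (idsL-≐ (map-++₃ Γl as σ)) (≐-refl {xs = toTensor as' ⟦ t' ⟧ ∷ idsL (i₀* ρ)})))
    p₂ = ⟦castC⟧ (sym (reassoc₂ Γl γ σ (γ' ++ ρ)))
           (letBodyC (Γl ++ γ ++ σ) ρ (castC (reassoc₂ Γl γ σ (as' ++ ρ)) (inst P γ)) t')
           (letT δ δ' s t)
         ⟫ ⟦let⟧ (Γl ++ γ ++ σ) ρ Y₁ t'
         ⟫ ∘-cong≋ (lift-cong-reindex (map-++₃ Γl γ σ) refl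
                       (map-++₃ (Γl ++ γ ++ σ) as' ρ) (map-++₅ˡ Γl γ σ as' ρ) ≋-refl)
             (≐→≋* (++H-cong≐ (idsL-≐ (map-++₃ Γl γ σ)) (≐-refl {xs = toTensor as' ⟦ t' ⟧ ∷ idsL (i₀* ρ)})))
    pW2 = ⟦castC⟧ (reassoc₂ Γl γ σ (as' ++ ρ)) (inst P γ) (letT δ δ' s t)
          ⟫ ih ⟫ ⟦let⟧ Γl (σ ++ as' ++ ρ) W t
          ⟫ ∘-cong≋ (lift-cong-reindex refl (map-++₃ σ as' ρ) (map-++₃ Γl as (σ ++ as' ++ ρ)) eX' ≋-refl)
              (≐→≋* (++H-cong≐ (≐-refl {xs = idsL (i₀* Γl)})
                       (∷-cong≐ (toTensor as ⟦ t ⟧) (idsL-≐ (map-++₃ σ as' ρ)))))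

  ⟦float⟧ : ∀ {δ δ' b Γl Γr c as γ} (P : PCtx δ δ' b Γl Γr c)
            (s : Term (δ ++ as ++ δ') b) (t : Term γ (tensor as)) → Floats P s t
  ⟦float⟧ phole s t = ≋-refl
  ⟦float⟧ (ptup ss₁ P ss₂) s t = ⟦float⟧-tup ss₁ P ss₂ s t (⟦float⟧ P s t)
  ⟦float⟧ (papp f ss₁ P ss₂) s t = ⟦float⟧-app f ss₁ P ss₂ s t (⟦float⟧ P s t)
  ⟦float⟧ (pletBound σ σ' s' P) s t = ⟦float⟧-letBound σ σ' s' P s t (⟦float⟧ P s t)
  ⟦float⟧ (pletBodyL σ ρ P t') s t = ⟦float⟧-letBodyL σ ρ P t' s t (⟦float⟧ P s t)
  ⟦float⟧ (pletBodyR σ ρ P t') s t = ⟦float⟧-letBodyR σ ρ P t' s t (⟦float⟧ P s t)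

  ⟦⟧-resp-Ax : ∀ {Γ a} {s s' : Term Γ a} → T.Ax s s' → ⟦ s ⟧ ≋ ⟦ s' ⟧
  ⟦⟧-resp-Ax (T.float P s t) = ⟦float⟧ P s t
  ⟦⟧-resp-Ax (T.beta s L ts) = ⟦beta⟧ s L ts

  ⟦⟧-resp-Step : ∀ {Γ a} {s s' : Term Γ a} → T.Step s s' → ⟦ s ⟧ ≋ ⟦ s' ⟧
  ⟦⟧-resp-Step (T.ctx C ax) = ⟦plug⟧-cong C (⟦⟧-resp-Ax ax)
  ⟦⟧-resp-Step (T.eta E _ {s} _) = ⟦plug⟧-cong E (⟦etaExp⟧ s)

  ⟦⟧-resp-∼ : ∀ {Γ a} {s s' : Term Γ a} → s T.∼ s' → ⟦ s ⟧ ≈ ⟦ s' ⟧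
  ⟦⟧-resp-∼ ε = ≈-refl
  ⟦⟧-resp-∼ (fwd st ◅ rest) = ≈-trans (≋→≈ (⟦⟧-resp-Step st)) (⟦⟧-resp-∼ rest)
  ⟦⟧-resp-∼ (bwd st ◅ rest) = ≈-trans (≈-sym (≋→≈ (⟦⟧-resp-Step st))) (⟦⟧-resp-∼ rest)

  interpretation : RepFunctor (FR A R) S
  interpretation = record
    { F₀ = i₀
    ; F₁ = ⟦_⟧
    ; F-cong = ⟦⟧-resp-∼
    ; F-id = λ a → ≈-refl
    ; F-∘ = λ f fs → ≋→≈ (⟦sub⟧ f fs ⟫ ∘-cong≋ʳ ⟦ f ⟧ (≡→≋* (⟦⟧*-mapHL fs)))
    ; F-⊗ = i₀-⊗
    ; F-re = λ as → ≋→≈ (subst-≋ (i₀-⊗ as) _ ⟫ ⟦tup⟧ (vars as)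
                         ⟫ ∘-cong≋ʳ (re _) (≐→≋* (⟦vars⟧ as)) ⟫ ≈→≋ (id-right _))
    }

  ⟦gen⟧ : ∀ {as b} (f : R as b) → ⟦ T.gen f ⟧ ≈ i₁ f
  ⟦gen⟧ {as} f = ≋→≈ (∘-cong≋ʳ (i₁ f) (≐→≋* (⟦vars⟧ as)) ⟫ ≈→≋ (id-right (i₁ f)))

  ⟦gen⟧-castH : ∀ {as b} (f : R as b) →
                castH S (λ _ → refl) (RepFunctor.F₁ interpretation (T.gen f)) ≈ i₁ f
  ⟦gen⟧-castH f = ≋→≈ (castH-≋ (λ _ → refl) ⟦ T.gen f ⟧ ⟫ ≈→≋ (⟦gen⟧ f))
module Uniqueness (A : Set) (R : Signature A) {o h e} (S : MultiData o h e)
         (isRep : IsRepMulticategory S) (i : SigMap A R S)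
         (G : RepFunctor (FR A R) S) (eG : ∀ a → RepFunctor.F₀ G a ≡ SigMap.i₀ i a)
         (hG : ∀ {as b} (f : R as b) →
               MultiData._≈_ S (castH S eG (RepFunctor.F₁ G (Free.gen A R f))) (SigMap.i₁ i f))
         where
  open MultiData S
  open MOps S
  open MulticategoryProperties S isRep
  open LiftProperties S isRep
  open Free A R
    using (Term; Terms; var; app; tup; letT; vars; sub; gen; _∼_; hole; lhole)
  private module T = Free A R
  open SubstitutionProperties A R
  open Interpretation A R S isRep i
  open RepFunctor G renaming (F₀ to G₀; F₁ to G₁; F-cong to G-cong; F-id to G-id;
                              F-∘ to G-∘; F-⊗ to G-⊗; F-re to G-re)
  open MapHLProperties (FR A R) S G₀ G₁ renaming (mapF to mapG)

  mapG-vars : ∀ Γ → mapG (vars Γ) ≋* idsL (i₀* Γ)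
  mapG-vars [] = ≋*-refl
  mapG-vars (a ∷ Γ) = ≐→≋* (mapHL-∷ var (vars Γ))
                      ⟫* ∷-cong≋* (≈→≋ (G-id a) ⟫ id-≋ (eG a)) (mapG-vars Γ)

  G-re≋ : ∀ as → G₁ (tup (vars as)) ≋ re (i₀* as)
  G-re≋ as = ≋-sym (subst-≋ (G-⊗ as) _) ⟫ ≈→≋ (G-re as) ⟫ re-≋ (map-cong eG as)

  G-letVar≋lift : ∀ δ δ' {as b} (s : Term (δ ++ as ++ δ') b) → G₁ s ≋ ⟦ s ⟧ →
                  G₁ (letT δ δ' s var) ≋ liftᵢ δ as δ' ⟦ s ⟧
  G-letVar≋lift δ δ' {as} s G≋ =
    ≋-sym (lift-unique-≋* (i₀* δ) (i₀* as) (i₀* δ') (map-++₃ δ as δ') ⟦ s ⟧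
             (G₁ (letT δ δ' s var)) (mapG re-vars) mapG-re-vars G-letVar∘re)
    where
    re-vars = vars δ T.++H (tup (vars as) T.∷ vars δ')
    mapG-re-vars : mapG re-vars ≋* reAt (i₀* δ) (i₀* as) (i₀* δ')
    mapG-re-vars =
      ≐→≋* (mapHL-++H (vars δ) (tup (vars as) T.∷ vars δ'))
      ⟫* ++H-cong≋* (mapG-vars δ)
           (≐→≋* (mapHL-∷ (tup (vars as)) (vars δ')) ⟫* ∷-cong≋* (G-re≋ as) (mapG-vars δ'))
    β : letT δ δ' s (tup (vars as)) ∼ sub s (vars δ T.++H (vars as T.++H vars δ'))
    β = fwd (T.ctx hole (T.beta s lhole (vars as))) ◅ ε
    G-letVar∘re : (G₁ (letT δ δ' s var) ∘ mapG re-vars) ≋ ⟦ s ⟧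
    G-letVar∘re = ≈→≋ (≈-sym (G-∘ (letT δ δ' s var) re-vars))
                  ⟫ ≡→≋ (cong G₁ (letVar-sub δ δ' s (tup (vars as))))
                  ⟫ ≈→≋ (G-cong β)
                  ⟫ ≡→≋ (cong G₁ (sub-vars₃ δ as δ' s))
                  ⟫ G≋

  G≋⟦⟧ : ∀ {Γ a} (s : Term Γ a) → G₁ s ≋ ⟦ s ⟧
  G*≋⟦⟧* : ∀ {Γ as} (ss : Terms Γ as) → mapG ss ≋* ⟦ ss ⟧*
  G≋⟦⟧ (var {a}) = ≈→≋ (G-id a) ⟫ id-≋ (eG a)
  G≋⟦⟧ (app f ss) =
    ≡→≋ (cong (λ z → G₁ (app f z)) (sym (vars-sub* ss)))
    ⟫ ≈→≋ (G-∘ (gen f) ss)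
    ⟫ ∘-cong≋ (≋-sym (castH-≋ eG (G₁ (gen f))) ⟫ ≈→≋ (hG f)) (G*≋⟦⟧* ss)
  G≋⟦⟧ (tup {as = as} ss) =
    ≡→≋ (cong (λ z → G₁ (tup z)) (sym (vars-sub* ss)))
    ⟫ ≈→≋ (G-∘ (tup (vars as)) ss)
    ⟫ ∘-cong≋ (G-re≋ as) (G*≋⟦⟧* ss)
    ⟫ ≋-sym (⟦tup⟧ ss)
  G≋⟦⟧ (letT {as} δ δ' s t) =
    ≡→≋ (cong G₁ (sym (letVar-sub δ δ' s t)))
    ⟫ ≈→≋ (G-∘ (letT δ δ' s var) (vars δ T.++H (t T.∷ vars δ')))
    ⟫ ∘-cong≋ (G-letVar≋lift δ δ' s (G≋⟦⟧ s))
        (≐→≋* (mapHL-++H (vars δ) (t T.∷ vars δ'))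
         ⟫* ++H-cong≋* (mapG-vars δ)
              (≐→≋* (mapHL-∷ t (vars δ'))
               ⟫* ∷-cong≋* (G≋⟦⟧ t ⟫ ≋-sym (toTensor-≋ as ⟦ t ⟧)) (mapG-vars δ')))
    ⟫ ≋-sym (⟦let⟧ δ δ' s t)
  G*≋⟦⟧* T.[] = ≋*-refl
  G*≋⟦⟧* (s T.∷ ss) =
    ≐→≋* (mapHL-∷ s ss) ⟫* ∷-cong≋* (G≋⟦⟧ s) (G*≋⟦⟧* ss) ⟫* ≋*-sym (≐→≋* (⟦∷⟧ s ss))

  castH-G≈castH-⟦⟧ : ∀ {Γ a} (s : Term Γ a) → castH S eG (G₁ s) ≈ castH S (λ _ → refl) ⟦ s ⟧
  castH-G≈castH-⟦⟧ s =
    ≋→≈ (castH-≋ eG (G₁ s) ⟫ G≋⟦⟧ s ⟫ ≋-sym (castH-≋ (λ _ → refl) ⟦ s ⟧))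


theorem3p15 : ∀ {o h e : Level} (A : Set) (R : Signature A)
    (S : MultiData o h e) → IsRepMulticategory S → (i : SigMap A R S) →
    Σ (RepFunctor (FR A R) S) λ F →
      Σ (∀ a → RepFunctor.F₀ F a ≡ SigMap.i₀ i a) λ eF →
        (∀ {as b} (f : R as b) →
           MultiData._≈_ S (castH S eF (RepFunctor.F₁ F (Free.gen A R f)))
                           (SigMap.i₁ i f))
        ×
        (∀ (G : RepFunctor (FR A R) S)
           (eG : ∀ a → RepFunctor.F₀ G a ≡ SigMap.i₀ i a) →
           (∀ {as b} (f : R as b) →
              MultiData._≈_ S (castH S eG (RepFunctor.F₁ G (Free.gen A R f)))
                              (SigMap.i₁ i f)) →
           ∀ {Γ a} (s : Free.Term A R Γ a) →
             MultiData._≈_ S (castH S eG (RepFunctor.F₁ G s))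
                             (castH S eF (RepFunctor.F₁ F s)))
theorem3p15 A R S isRep i =
  interpretation , (λ _ → refl) , ⟦gen⟧-castH ,
  λ G eG hG → Uniqueness.castH-G≈castH-⟦⟧ A R S isRep i G eG hG
  where open Soundness A R S isRep i
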